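{- Let $\alpha=(\alpha_1,\ldots,\alpha_h)$ be a partition, let $k$ be the minimal index with $1\leq k\leq h+1$ such that $\alpha_k+\cdots+\alpha_h<\alpha_1-\alpha_2$, and let $x=\alpha_k+\cdots+\alpha_h$. Assume: $\alpha\notin\mathrm{Sign}$, $(\alpha_2,\ldots,\alpha_h)\in\mathrm{Sign}$ and $\alpha_1>\alpha_2>\alpha_3+\cdots+\alpha_h$; $k\leq h$; $\alpha_1-\alpha_2$ is not a part of $\alpha$; $\alpha_{k-1}\leq x$; and none of the following holds: (1) $(\alpha_{k-1},\ldots,\alpha_h)=(3,2,1,1)$ and $\alpha_1=\alpha_2+\alpha_{k-1}+\cdots+\alpha_h$; (2) $(\alpha_{k-1},\ldots,\alpha_h)=(5,3,2,1)$ and $\alpha_1=\alpha_2+\alpha_{k-1}+\cdots+\alpha_h$; (3) $(\alpha_{k-1},\ldots,\alpha_h)=(a,a-1,1)$ for some $a\geq 2$ and $\alpha_1=\alpha_2+\alpha_{k-1}+\cdots+\alpha_h-1$; (4) $(\alpha_{k-1},\ldots,\alpha_h)=(a,a-1,2,1)$ for some $a\geq 4$ and $\alpha_1=\alpha_2+\alpha_{k-1}+\cdots+\alpha_h-3$; (5) $(\alpha_{k-1},\ldots,\alpha_h)=(a,a-1,3,1)$ for some $a\geq 5$ and $\alpha_1=\alpha_2+\alpha_{k-1}+\cdots+\alpha_h-4$. Then $\beta=(|\alpha|-\alpha_1,x+1,1^{\alpha_1-x-1})$ is a partition, $h^\beta_{2,1}=\alpha_1$, and $\chi^\beta_\alp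ha=2(-1)^{\alpha_1-x-1}$.
   Context: Empty sums are $0$. $|\lambda|$ is the sum of the parts of $\lambda$; $(b_1,\ldots,b_t,1^m)$ denotes the partition with parts $b_1,\ldots,b_t$ followed by $m$ parts equal to $1$. $h^\lambda_{i,j}$ is the hook length of node $(i,j)$ (row $i$, column $j$) of the Young diagram of $\lambda$. For partitions $\lambda,\mu$ of the same $n$, $\chi^\lambda_\mu$ is the value of the irreducible character of $S_n$ labeled by $\lambda$ on permutations of cycle type $\mu$. $\mathrm{Sign}$ denotes the set of all partitions $(\gamma_1,\ldots,\gamma_r)$ for which there exists $s$ with $0\leq s\leq r$ such that: (i) $\gamma_i>\gamma_{i+1}+\cdots+\gamma_r$ for $1\leq i\leq s$; and (ii) $(\gamma_{s+1},\ldots,\gamma_r)$ is one of $()$, $(1,1)$, $(3,2,1,1)$, $(5,3,2,1)$, $(a,a-1,1)$ with $a\geq 2$, $(a,a-1,2,1)$ with $a\geq 4$, or $(a,a-1,3,1)$ with $a\geq 5$. -}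

module Defs where

open import Data.Nat using (ℕ; zero; suc; _+_; _*_; _∸_; _≤_; _<_; _>_; _≥_; _≡ᵇ_; _<ᵇ_)
open import Data.Bool using (Bool; true; false; if_then_else_; _∧_; not)
open import Data.List using (List; []; _∷_; length; drop; replicate; filter; map; foldr)
open import Data.Bool.ListAction using (any; all)
open import Data.Nat.ListAction using (sum)
open import Data.Integer as ℤ using (ℤ; +_; -[1+_])
open import Relation.Binary.PropositionalEquality using (_≡_)
open import Data.Product using (Σ; _×_)

data NonIncr : List ℕ → Set where
  []  : NonIncr []
  [_] : ∀ a → NonIncr (a ∷ [])
  _∷_ : ∀ {a b l} → b ≤ a → NonIncr (b ∷ l) → NonIncr (a ∷ b ∷ l)

data AllPos : List ℕ → Set where
  []  : AllPos []
  _∷_ : ∀ {a l} → 0 < a → AllPos l → AllPos (a ∷ l)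

IsPartition : List ℕ → Set
IsPartition l = NonIncr l × AllPos l

-- 1-indexed part λ_i (0 if i is out of range, including i = 0)
part : List ℕ → ℕ → ℕ
part l       zero          = 0
part []      (suc i)       = 0
part (a ∷ l) (suc zero)    = a
part (a ∷ l) (suc (suc i)) = part l (suc i)

conj : List ℕ → ℕ → ℕ
conj l j = length (filter (λ a → j Data.Nat.≤? a) l)

hook : List ℕ → ℕ → ℕ → ℕ
hook l i j = (part l i ∸ j) + (conj l j ∸ i) + 1

data SignBase : List ℕ → Set where
  sb-empty : SignBase []
  sb-11    : SignBase (1 ∷ 1 ∷ [])
  sb-3211  : SignBase (3 ∷ 2 ∷ 1 ∷ 1 ∷ [])
  sb-5321  : SignBase (5 ∷ 3 ∷ 2 ∷ 1 ∷ [])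
  sb-aa1   : ∀ a → 2 ≤ a → SignBase (a ∷ (a ∸ 1) ∷ 1 ∷ [])
  sb-aa21  : ∀ a → 4 ≤ a → SignBase (a ∷ (a ∸ 1) ∷ 2 ∷ 1 ∷ [])
  sb-aa31  : ∀ a → 5 ≤ a → SignBase (a ∷ (a ∸ 1) ∷ 3 ∷ 1 ∷ [])

data SignShape : List ℕ → Set where
  base : ∀ {γ} → SignBase γ → SignShape γ
  step : ∀ {a γ} → a > sum γ → SignShape γ → SignShape (a ∷ γ)

Sign : List ℕ → Set
Sign γ = IsPartition γ × SignShape γ

-- Irreducible characters of S_n via the Murnaghan–Nakayama rule,
-- implemented on beta-sets (first column hook lengths).
-- Removing an r-rim hook = moving a bead x ∈ X to x - r ∉ X (x ≥ r);
-- its leg length is #{ y ∈ X : x - r < y < x }.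

betaSet : List ℕ → List ℕ
betaSet l = go l (length l)
  where
  go : List ℕ → ℕ → List ℕ
  go []      n = []
  go (a ∷ as) n = (a + (n ∸ 1)) ∷ go as (n ∸ 1)

memᵇ : ℕ → List ℕ → Bool
memᵇ x = any (λ y → x ≡ᵇ y)

sgn : ℕ → ℤ
sgn zero    = + 1
sgn (suc m) = ℤ.- sgn m

replaceBead : ℕ → ℕ → List ℕ → List ℕ
replaceBead x y []      = []
replaceBead x y (z ∷ zs) = if x ≡ᵇ z then y ∷ zs else z ∷ replaceBead x y zs

legLen : ℕ → ℕ → List ℕ → ℕ
legLen lo hi X = length (filter (λ y → (lo Data.Nat.<? y) Relation.Nullary.Decidable.×-dec (y Data.Nat.<? hi)) X)
  where import Relation.Nullary.Decidable

chiβ : List ℕ → List ℕ → ℤ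
chiβ X []      = if all (λ y → y <ᵇ length X) X then + 1 else + 0
chiβ X (r ∷ μ) = foldr ℤ._+_ (+ 0) (map term X)
  where
  term : ℕ → ℤ
  term x = if (r Data.Nat.≤ᵇ x) ∧ not (memᵇ (x ∸ r) X)
           then sgn (legLen (x ∸ r) x X) ℤ.* chiβ (replaceBead x (x ∸ r) X) μ
           else + 0

χ : List ℕ → List ℕ → ℤ
χ λ' μ = chiβ (betaSet λ') μ

{-# OPTIONS --safe #-}
-- In the beta-set picture β has beads {T, α₁, 1, …, N₀}, N₀ = α₁ − x − 1, and χ^β_α is computed
-- with the Murnaghan–Nakayama rule by sliding beads. Removing the α₁-hook either moves the bead α₁
-- to 0, leaving a one-row shape and contributing (−1)^N₀, or moves T down by α₁. In that branch the
-- α₂-hook can only move the bead α₂ to 0 (sign (−1)^(α₂−1)), after which 0, …, α₂ − 1 form a full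
-- bottom segment that can be discarded; what remains is the beta-set {|rest| − x, d, 1, …, d − x − 1}
-- with d = α₁ − α₂, evaluated at rest = (α₃, …, α_h) ∈ Sign. Along the recursive description of
-- Sign this residual character is (−1)^(d−x), up to the sign of ordering its two top beads: a part
-- larger than the sum of the later ones can only move the top bead, and the base shapes are
-- evaluated directly, the hypotheses α_{k−1} ≤ x, α₁ − α₂ ∉ α and the exclusions (1)–(5) ruling
-- out the configurations where this fails. The ordering sign also occurs in the first move of T
-- and cancels, so this branch too contributes (−1)^(α₂−1+d−x) = (−1)^N₀.

module Submission where

open import Defs
open import Data.Nat
  using (ℕ; zero; suc; _+_; _∸_; _≤_; _<_; _>_; z≤n; s≤s; z<s; s<s; s<s⁻¹; >-nonZero; _≡ᵇ_; _<ᵇ_; _≤ᵇ_; _≟_; _<?_; _≤?_)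
open import Data.Nat.Properties
open import Data.Nat.ListAction using (sum)
import Data.Nat.Solver
open import Data.Bool using (Bool; true; false; if_then_else_; _∧_; _∨_; not; T)
open import Data.Bool.Properties using (∨-isCommutativeMonoid; ∧-isCommutativeMonoid)
open import Data.Bool.ListAction using (any; all)
open import Data.List using (List; []; _∷_; length; drop; replicate; map; foldr; _++_; _∷ʳ_; downFrom; upTo)
open import Data.List.Properties
  using (map-++; ++-identityʳ; ++-assoc; length-map; filter-accept; filter-reject; map-id; map-cong; map-∘; length-replicate; filter-all)
open import Data.List.Membership.Propositional using (_∈_; _∉_)
open import Data.List.Relation.Unary.Any using (here; there)
open import Data.List.Relation.Unary.All as All using (All; []; _∷_)
open import Data.List.Membership.Propositional.Properties using (∈-upTo⁺)
import Data.List.Relation.Unary.All.Properties as Allₚ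
open import Data.List.Relation.Binary.Permutation.Propositional
  using (_↭_; prep; swap; ↭-sym; ↭⇒↭ₛ) renaming (refl to ↭-refl; trans to ↭-trans)
open import Data.List.Relation.Binary.Permutation.Propositional.Properties
  using (↭-length; map⁺; filter-↭; ∷↭∷ʳ; ++⁺ˡ)
open import Data.List.Relation.Binary.Permutation.Setoid.Properties using (foldr-commMonoid)
open import Data.Integer as ℤ using (ℤ; +_)
import Data.Integer.Properties as ℤP
import Data.Integer.Solver
open import Data.Product using (_×_; _,_; proj₁; proj₂; ∃-syntax)
open import Data.Sum using (_⊎_; inj₁; inj₂)
open import Data.Empty using (⊥-elim)
open import Function using (_∘_)
open import Algebra.Structures using (IsCommutativeMonoid)
open import Relation.Nullary using (¬_; yes; no)
open import Relation.Nullary.Decidable using (dec-true; dec-false; _×-dec_)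
open import Relation.Binary.PropositionalEquality
module ℕSolver = Data.Nat.Solver.+-*-Solver
module ℤSolver = Data.Integer.Solver.+-*-Solver

≡ᵇ-true : ∀ {m n} → m ≡ n → (m ≡ᵇ n) ≡ true
≡ᵇ-true = dec-true (_ ≟ _)

≡ᵇ-false : ∀ {m n} → m ≢ n → (m ≡ᵇ n) ≡ false
≡ᵇ-false = dec-false (_ ≟ _)

<ᵇ-true : ∀ {m n} → m < n → (m <ᵇ n) ≡ true
<ᵇ-true = dec-true (_ <? _)

<ᵇ-false : ∀ {m n} → n ≤ m → (m <ᵇ n) ≡ false
<ᵇ-false = dec-false (_ <? _) ∘ ≤⇒≯

≤ᵇ-true : ∀ {m n} → m ≤ n → (m ≤ᵇ n) ≡ true
≤ᵇ-true = dec-true (_ ≤? _)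

≤ᵇ-false : ∀ {m n} → n < m → (m ≤ᵇ n) ≡ false
≤ᵇ-false = dec-false (_ ≤? _) ∘ <⇒≱

sgn-+ : ∀ m n → sgn (m + n) ≡ sgn m ℤ.* sgn n
sgn-+ zero    n = sym (ℤP.*-identityˡ (sgn n))
sgn-+ (suc m) n = trans (cong ℤ.-_ (sgn-+ m n)) (ℤP.neg-distribˡ-* (sgn m) (sgn n))

sgn-square : ∀ m → sgn m ℤ.* sgn m ≡ + 1
sgn-square m = trans (sym (sgn-+ m m)) (sgn-even m)
  where
  sgn-even : ∀ m → sgn (m + m) ≡ + 1
  sgn-even zero    = refl
  sgn-even (suc m) = trans (cong (ℤ.-_ ∘ sgn) (+-suc m m)) (trans (ℤP.neg-involutive _) (sgn-even m))

κ*[s*[κ*n]]≡s*n : ∀ κ s n → κ ℤ.* κ ≡ + 1 → κ ℤ.* (s ℤ.* (κ ℤ.* n)) ≡ s ℤ.* n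
κ*[s*[κ*n]]≡s*n κ s n κ²≡1 = begin
  κ ℤ.* (s ℤ.* (κ ℤ.* n)) ≡⟨ solve 3 (λ k s n → k :* (s :* (k :* n)) := (k :* k) :* (s :* n)) refl κ s n ⟩
  (κ ℤ.* κ) ℤ.* (s ℤ.* n) ≡⟨ cong (ℤ._* (s ℤ.* n)) κ²≡1 ⟩
  + 1 ℤ.* (s ℤ.* n)       ≡⟨ ℤP.*-identityˡ (s ℤ.* n) ⟩
  s ℤ.* n                 ∎
  where
  open ≡-Reasoning
  open ℤSolver using (solve; _:*_; _:=_)

i+i≡2*i : ∀ z → z ℤ.+ z ≡ + 2 ℤ.* z
i+i≡2*i z = sym (trans (ℤP.*-distribʳ-+ z (+ 1) (+ 1)) (cong₂ ℤ._+_ (ℤP.*-identityˡ z) (ℤP.*-identityˡ z)))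

∸-split : ∀ {x d} → x < d → d ≡ x + suc (d ∸ x ∸ 1)
∸-split {x} {d} x<d =
  trans (sym (m+[n∸m]≡n (<⇒≤ x<d))) (cong (_+_ x) (sym (suc-pred (d ∸ x) {{>-nonZero (m<n⇒0<n∸m x<d)}})))

≤∸1+suc : ∀ a c → a ≤ (a ∸ 1) + suc c
≤∸1+suc zero    c = z≤n
≤∸1+suc (suc a) c = ≤-trans (s≤s (m≤m+n a c)) (≤-reflexive (sym (+-suc a c)))

+-∸-shift : ∀ a₂ {d s} c → c ≤ s → d ≡ s ∸ c → a₂ + d ≡ (a₂ + s) ∸ c
+-∸-shift a₂ c c≤s d≡ = trans (cong (_+_ a₂) d≡) (sym (+-∸-assoc a₂ c≤s))

sum-drop-≤ : ∀ j L → sum (drop j L) ≤ sum L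
sum-drop-≤ zero    L       = ≤-refl
sum-drop-≤ (suc j) []      = ≤-refl
sum-drop-≤ (suc j) (y ∷ L) = ≤-trans (sum-drop-≤ j L) (m≤n+m (sum L) y)

<head⇒≤sum : ∀ {a L c} seg → c < a → seg ≡ a ∷ L → c ≤ sum seg
<head⇒≤sum {a} {L} _ c<a refl = ≤-trans (<⇒≤ c<a) (m≤m+n a (sum L))

column : ℕ → List ℕ
column zero    = []
column (suc n) = suc n ∷ column n

length-column : ∀ N → length (column N) ≡ N
length-column zero    = refl
length-column (suc N) = cong suc (length-column N)

∈-column : ∀ {z} N → 1 ≤ z → z ≤ N → z ∈ column N
∈-column {z} zero    1≤z z≤0 = ⊥-elim (<⇒≱ 1≤z z≤0)
∈-column {z} (suc N) 1≤z z≤N with z ≟ suc N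
... | yes refl = here refl
... | no  z≢N  = there (∈-column N 1≤z (m<1+n⇒m≤n (≤∧≢⇒< z≤N z≢N)))

∈-0∷column : ∀ {z} N → z ≤ N → z ∈ 0 ∷ column N
∈-0∷column {zero}  N _   = here refl
∈-0∷column {suc z} N z≤N = there (∈-column N z<s z≤N)

∉-column : ∀ {z} N → N < z → z ∉ column N
∉-column (suc N) N<z (here refl) = <-irrefl refl N<z
∉-column (suc N) N<z (there z∈) = ∉-column N (<-trans (n<1+n N) N<z) z∈

0∉column : ∀ N → 0 ∉ column N
0∉column (suc N) (there 0∈) = 0∉column N 0∈

∉-∷ : ∀ {z y} {X : List ℕ} → z ≢ y → z ∉ X → z ∉ y ∷ X
∉-∷ z≢y z∉X (here z≡y)  = z≢y z≡y
∉-∷ z≢y z∉X (there z∈X) = z∉X z∈X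

memᵇ-true : ∀ {z} {X} → z ∈ X → memᵇ z X ≡ true
memᵇ-true {z} (here refl) rewrite ≡ᵇ-true {z} refl = refl
memᵇ-true {z} (there {x = y} z∈X) with z ≡ᵇ y
... | true  = refl
... | false = memᵇ-true z∈X

memᵇ-false : ∀ {z} X → z ∉ X → memᵇ z X ≡ false
memᵇ-false     []      _   = refl
memᵇ-false {z} (y ∷ X) z∉ rewrite ≡ᵇ-false (z∉ ∘ here) = memᵇ-false X (z∉ ∘ there)

all-column : ∀ N L → N < L → all (_<ᵇ L) (column N) ≡ true
all-column zero    L _   = refl
all-column (suc N) L N<L rewrite <ᵇ-true N<L = all-column N L (<-trans (n<1+n N) N<L)

replaceBead-head : ∀ x y X → replaceBead x y (x ∷ X) ≡ y ∷ X
replaceBead-head x y X rewrite ≡ᵇ-true {x} refl = refl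

replaceBead-∷ : ∀ {x z} y X → x ≢ z → replaceBead x y (z ∷ X) ≡ z ∷ replaceBead x y X
replaceBead-∷ y X x≢z rewrite ≡ᵇ-false x≢z = refl

legLen-∷-in : ∀ {lo hi z} X → lo < z → z < hi → legLen lo hi (z ∷ X) ≡ suc (legLen lo hi X)
legLen-∷-in {lo} {hi} X p q = cong length (filter-accept (λ y → (lo <? y) ×-dec (y <? hi)) (p , q))

legLen-∷-out : ∀ {lo hi z} X → ¬ (lo < z × z < hi) → legLen lo hi (z ∷ X) ≡ legLen lo hi X
legLen-∷-out {lo} {hi} X p = cong length (filter-reject (λ y → (lo <? y) ×-dec (y <? hi)) p)

legLen-∷-above : ∀ {lo hi z} X → hi ≤ z → legLen lo hi (z ∷ X) ≡ legLen lo hi X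
legLen-∷-above X hi≤z = legLen-∷-out X (λ (_ , z<hi) → <⇒≱ z<hi hi≤z)

legLen-column-low : ∀ lo hi N → N ≤ lo → legLen lo hi (column N) ≡ 0
legLen-column-low lo hi zero    _    = refl
legLen-column-low lo hi (suc N) N≤lo =
  trans (legLen-∷-out (column N) (λ (lo<N , _) → <⇒≱ lo<N N≤lo)) (legLen-column-low lo hi N (<⇒≤ N≤lo))

legLen-column-inside : ∀ hi N → N < hi → legLen 0 hi (column N) ≡ N
legLen-column-inside hi zero    _    = refl
legLen-column-inside hi (suc N) N<hi =
  trans (legLen-∷-in (column N) z<s N<hi) (cong suc (legLen-column-inside hi N (<⇒≤ N<hi)))

legLen-column-cut : ∀ hi N → 1 ≤ hi → hi ≤ N → legLen 0 hi (column N) ≡ hi ∸ 1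
legLen-column-cut hi zero    1≤hi hi≤0 = ⊥-elim (<⇒≱ 1≤hi hi≤0)
legLen-column-cut hi (suc N) 1≤hi hi≤N with hi ≟ suc N
... | yes refl = trans (legLen-∷-above (column N) ≤-refl) (legLen-column-inside (suc N) N ≤-refl)
... | no  hi≢  = trans (legLen-∷-above (column N) hi≤N)
                       (legLen-column-cut hi N 1≤hi (m<1+n⇒m≤n (≤∧≢⇒< hi≤N hi≢)))

-- The number of beads (0 or 1) jumped when the top bead slides down to v past a bead at d.
crossing : ℕ → ℕ → ℕ
crossing v d = if v <ᵇ d then 1 else 0

crossing-+ : ∀ a u d → crossing (a + u) (a + d) ≡ crossing u d
crossing-+ zero    u d = refl
crossing-+ (suc a) u d = crossing-+ a u d

sgn-crossing-below : ∀ {u d} N → u < d → sgn (crossing u d) ℤ.* sgn (suc N) ≡ sgn N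
sgn-crossing-below N u<d rewrite <ᵇ-true u<d = trans (ℤP.-1*i≡-i _) (ℤP.neg-involutive (sgn N))

sgn-crossing-above : ∀ {u d} z → d ≤ u → sgn (crossing u d) ℤ.* z ≡ z
sgn-crossing-above z d≤u rewrite <ᵇ-false d≤u = ℤP.*-identityˡ z

legLen-top : ∀ w T a N → a < T → N ≤ w → legLen w T (T ∷ a ∷ column N) ≡ crossing w a
legLen-top w T a N a<T N≤w with w <? a
... | yes w<a rewrite <ᵇ-true w<a = trans (legLen-∷-above (a ∷ column N) ≤-refl)
  (trans (legLen-∷-in (column N) w<a a<T) (cong suc (legLen-column-low w T N N≤w)))
... | no  w≮a rewrite <ᵇ-false (≮⇒≥ w≮a) = trans (legLen-∷-above (a ∷ column N) ≤-refl)
  (trans (legLen-∷-out (column N) (w≮a ∘ proj₁)) (legLen-column-low w T N N≤w))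

-- The term of bead x in chiβ X (r ∷ μ), which unfolds definitionally to Σℤ (mnTerm X r μ) X.
mnTerm : List ℕ → ℕ → List ℕ → ℕ → ℤ
mnTerm X r μ x = if (r ≤ᵇ x) ∧ not (memᵇ (x ∸ r) X)
                 then sgn (legLen (x ∸ r) x X) ℤ.* chiβ (replaceBead x (x ∸ r) X) μ
                 else + 0

Σℤ : (ℕ → ℤ) → List ℕ → ℤ
Σℤ f X = foldr ℤ._+_ (+ 0) (map f X)

mnTerm-low : ∀ X r μ x → x < r → mnTerm X r μ x ≡ + 0
mnTerm-low X r μ x x<r rewrite ≤ᵇ-false x<r = refl

mnTerm-blocked : ∀ X r μ x {y} → r ≤ x → x ∸ r ≡ y → y ∈ X → mnTerm X r μ x ≡ + 0
mnTerm-blocked X r μ x r≤x refl occ rewrite ≤ᵇ-true r≤x | memᵇ-true occ = refl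

mnTerm-move : ∀ X r μ x {y} → r ≤ x → x ∸ r ≡ y → y ∉ X →
  mnTerm X r μ x ≡ sgn (legLen y x X) ℤ.* chiβ (replaceBead x y X) μ
mnTerm-move X r μ x r≤x refl free rewrite ≤ᵇ-true r≤x | memᵇ-false X free = refl

mnTerm-move-vanish : ∀ X r μ x {y} → r ≤ x → x ∸ r ≡ y → y ∉ X → chiβ (replaceBead x y X) μ ≡ + 0 →
  mnTerm X r μ x ≡ + 0
mnTerm-move-vanish X r μ x {y} r≤x x∸r≡y free vanish = begin
  mnTerm X r μ x                                  ≡⟨ mnTerm-move X r μ x r≤x x∸r≡y free ⟩
  sgn (legLen y x X) ℤ.* chiβ (replaceBead x y X) μ ≡⟨ cong (sgn (legLen y x X) ℤ.*_) vanish ⟩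
  sgn (legLen y x X) ℤ.* + 0                      ≡⟨ ℤP.*-zeroʳ (sgn (legLen y x X)) ⟩
  + 0                                             ∎
  where open ≡-Reasoning

mnTerm-cong : ∀ X Y r μ x y → (r ≤ᵇ x) ≡ (r ≤ᵇ y) → memᵇ (x ∸ r) X ≡ memᵇ (y ∸ r) Y →
  legLen (x ∸ r) x X ≡ legLen (y ∸ r) y Y →
  chiβ (replaceBead x (x ∸ r) X) μ ≡ chiβ (replaceBead y (y ∸ r) Y) μ →
  mnTerm X r μ x ≡ mnTerm Y r μ y
mnTerm-cong X Y r μ x y e₀ e₁ e₂ e₃ rewrite e₀ | e₁ | e₂ | e₃ = refl

Σℤ-ext : ∀ {f g} X → (∀ y → f y ≡ g y) → Σℤ f X ≡ Σℤ g X
Σℤ-ext []      f≗g = refl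
Σℤ-ext (y ∷ X) f≗g = cong₂ ℤ._+_ (f≗g y) (Σℤ-ext X f≗g)

Σℤ-map-suc : ∀ f X → Σℤ f (map suc X) ≡ Σℤ (f ∘ suc) X
Σℤ-map-suc f []      = refl
Σℤ-map-suc f (w ∷ X) = cong (ℤ._+_ (f (suc w))) (Σℤ-map-suc f X)

Σℤ-column-zero : ∀ f N → (∀ y → 1 ≤ y → y ≤ N → f y ≡ + 0) → Σℤ f (column N) ≡ + 0
Σℤ-column-zero f zero    f≡0 = refl
Σℤ-column-zero f (suc N) f≡0 rewrite f≡0 (suc N) z<s ≤-refl =
  trans (ℤP.+-identityˡ _) (Σℤ-column-zero f N (λ y 1≤y y≤N → f≡0 y 1≤y (m≤n⇒m≤1+n y≤N)))

Σℤ-column-single : ∀ f N j → 1 ≤ j → j ≤ N → (∀ y → 1 ≤ y → y ≤ N → y ≢ j → f y ≡ + 0) →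
  Σℤ f (column N) ≡ f j
Σℤ-column-single f zero    j 1≤j j≤0 _   = ⊥-elim (<⇒≱ 1≤j j≤0)
Σℤ-column-single f (suc N) j 1≤j j≤N f≡0 with j ≟ suc N
... | yes refl = trans (cong (ℤ._+_ (f j)) (Σℤ-column-zero f N below)) (ℤP.+-identityʳ (f j))
  where
  below : ∀ y → 1 ≤ y → y ≤ N → f y ≡ + 0
  below y 1≤y y≤N = f≡0 y 1≤y (m≤n⇒m≤1+n y≤N) (<⇒≢ (s≤s y≤N))
... | no  j≢   rewrite f≡0 (suc N) z<s ≤-refl (j≢ ∘ sym) = trans (ℤP.+-identityˡ _)
  (Σℤ-column-single f N j 1≤j (m<1+n⇒m≤n (≤∧≢⇒< j≤N j≢)) (λ y 1≤y y≤N → f≡0 y 1≤y (m≤n⇒m≤1+n y≤N)))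

mnTerm-column-low : ∀ X r μ N → N < r → Σℤ (mnTerm X r μ) (column N) ≡ + 0
mnTerm-column-low X r μ N N<r =
  Σℤ-column-zero _ N (λ y _ y≤N → mnTerm-low X r μ y (≤-<-trans y≤N N<r))

foldr-↭ : ∀ {A : Set} {_∙_ : A → A → A} {ε : A} → IsCommutativeMonoid _≡_ _∙_ ε →
  ∀ {X Y} → X ↭ Y → foldr _∙_ ε X ≡ foldr _∙_ ε Y
foldr-↭ isCM X↭Y = foldr-commMonoid (setoid _) isCM (↭⇒↭ₛ X↭Y)

Σℤ-↭ : ∀ f {X Y} → X ↭ Y → Σℤ f X ≡ Σℤ f Y
Σℤ-↭ f = foldr-↭ ℤP.+-0-isCommutativeMonoid ∘ map⁺ f

any-↭ : ∀ (p : ℕ → Bool) {X Y} → X ↭ Y → any p X ≡ any p Y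
any-↭ p = foldr-↭ ∨-isCommutativeMonoid ∘ map⁺ p

all-↭ : ∀ (p : ℕ → Bool) {X Y} → X ↭ Y → all p X ≡ all p Y
all-↭ p = foldr-↭ ∧-isCommutativeMonoid ∘ map⁺ p

legLen-↭ : ∀ lo hi {X Y} → X ↭ Y → legLen lo hi X ≡ legLen lo hi Y
legLen-↭ lo hi = ↭-length ∘ filter-↭ (λ y → (lo <? y) ×-dec (y <? hi))

replaceBead-↭ : ∀ a b {X Y} → X ↭ Y → replaceBead a b X ↭ replaceBead a b Y
replaceBead-↭ a b ↭-refl = ↭-refl
replaceBead-↭ a b (prep x X↭Y) with a ≡ᵇ x
... | true  = prep b X↭Y
... | false = prep x (replaceBead-↭ a b X↭Y)
replaceBead-↭ a b (swap x y X↭Y) with a ≡ᵇ x in a≡x | a ≡ᵇ y in a≡y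
... | true  | true  rewrite ≡ᵇ⇒≡ a x (subst T (sym a≡x) _) | ≡ᵇ⇒≡ x y (subst T (sym a≡y) _) =
  prep b (prep y X↭Y)
... | true  | false = swap b y X↭Y
... | false | true  = swap x b X↭Y
... | false | false = swap x y (replaceBead-↭ a b X↭Y)
replaceBead-↭ a b (↭-trans X↭Y Y↭Z) = ↭-trans (replaceBead-↭ a b X↭Y) (replaceBead-↭ a b Y↭Z)

mutual
  chiβ-↭ : ∀ μ {X Y} → X ↭ Y → chiβ X μ ≡ chiβ Y μ
  chiβ-↭ []      {X} {Y} X↭Y rewrite ↭-length X↭Y =
    cong (if_then + 1 else + 0) (all-↭ (_<ᵇ length Y) X↭Y)
  chiβ-↭ (r ∷ μ) {X} {Y} X↭Y =
    trans (Σℤ-↭ (mnTerm X r μ) X↭Y) (Σℤ-ext Y λ z → mnTerm-↭ r μ z X↭Y)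

  mnTerm-↭ : ∀ r μ z {X Y} → X ↭ Y → mnTerm X r μ z ≡ mnTerm Y r μ z
  mnTerm-↭ r μ z {X} {Y} X↭Y =
    mnTerm-cong X Y r μ z z refl (any-↭ ((z ∸ r) ≡ᵇ_) X↭Y) (legLen-↭ (z ∸ r) z X↭Y)
                (chiβ-↭ μ (replaceBead-↭ z (z ∸ r) X↭Y))

memᵇ-shift : ∀ z X → memᵇ (suc z) (0 ∷ map suc X) ≡ memᵇ z X
memᵇ-shift z []      = refl
memᵇ-shift z (w ∷ X) = cong ((z ≡ᵇ w) ∨_) (memᵇ-shift z X)

legLen-shift : ∀ lo hi X → legLen (suc lo) (suc hi) (0 ∷ map suc X) ≡ legLen lo hi X
legLen-shift lo hi []      = refl
legLen-shift lo hi (w ∷ X) with (lo <? w) ×-dec (w <? hi)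
... | yes (lo<w , w<hi) = begin
  legLen (suc lo) (suc hi) (0 ∷ suc w ∷ map suc X) ≡⟨ legLen-∷-in (map suc X) (s<s lo<w) (s<s w<hi) ⟩
  suc (legLen (suc lo) (suc hi) (0 ∷ map suc X))   ≡⟨ cong suc (legLen-shift lo hi X) ⟩
  suc (legLen lo hi X)                             ≡⟨ legLen-∷-in X lo<w w<hi ⟨
  legLen lo hi (w ∷ X)                             ∎
  where open ≡-Reasoning
... | no  out = begin
  legLen (suc lo) (suc hi) (0 ∷ suc w ∷ map suc X)
    ≡⟨ legLen-∷-out (map suc X) (λ (p , q) → out (s<s⁻¹ p , s<s⁻¹ q)) ⟩
  legLen (suc lo) (suc hi) (0 ∷ map suc X)
    ≡⟨ legLen-shift lo hi X ⟩
  legLen lo hi X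
    ≡⟨ legLen-∷-out X out ⟨
  legLen lo hi (w ∷ X) ∎
  where open ≡-Reasoning

replaceBead-shift : ∀ a b X → replaceBead (suc a) (suc b) (map suc X) ≡ map suc (replaceBead a b X)
replaceBead-shift a b []      = refl
replaceBead-shift a b (w ∷ X) with a ≡ᵇ w
... | true  = refl
... | false = cong (suc w ∷_) (replaceBead-shift a b X)

all-shift : ∀ L X → all (_<ᵇ suc L) (map suc X) ≡ all (_<ᵇ L) X
all-shift L []      = refl
all-shift L (w ∷ X) = cong ((w <ᵇ L) ∧_) (all-shift L X)

chiβ-shift : ∀ μ X → AllPos μ → chiβ (0 ∷ map suc X) μ ≡ chiβ X μ
chiβ-shift []          X _ rewrite length-map suc X = cong (if_then + 1 else + 0) (all-shift (length X) X)
chiβ-shift (suc r ∷ μ) X (_ ∷ μ⁺) = trans (ℤP.+-identityˡ _)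
  (trans (Σℤ-map-suc (mnTerm X′ (suc r) μ) X) (Σℤ-ext X term-shift))
  where
  X′ = 0 ∷ map suc X
  term-shift : ∀ y → mnTerm X′ (suc r) μ (suc y) ≡ mnTerm X (suc r) μ y
  term-shift y with suc r ≤? y
  ... | yes r<y = mnTerm-cong X′ X (suc r) μ (suc y) y
          (trans (≤ᵇ-true (m≤n⇒m≤1+n r<y)) (sym (≤ᵇ-true r<y)))
          (trans (cong (λ t → memᵇ t X′) y∸r) (memᵇ-shift (y ∸ suc r) X))
          (trans (cong (λ t → legLen t (suc y) X′) y∸r) (legLen-shift (y ∸ suc r) y X))
          (begin
            chiβ (replaceBead (suc y) (y ∸ r) X′) μ
              ≡⟨ cong (λ t → chiβ (replaceBead (suc y) t X′) μ) y∸r ⟩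
            chiβ (0 ∷ replaceBead (suc y) (suc (y ∸ suc r)) (map suc X)) μ
              ≡⟨ cong (λ L → chiβ (0 ∷ L) μ) (replaceBead-shift y (y ∸ suc r) X) ⟩
            chiβ (0 ∷ map suc (replaceBead y (y ∸ suc r) X)) μ
              ≡⟨ chiβ-shift μ _ μ⁺ ⟩
            chiβ (replaceBead y (y ∸ suc r) X) μ ∎)
    where
    open ≡-Reasoning
    y∸r : y ∸ r ≡ suc (y ∸ suc r)
    y∸r = +-∸-assoc 1 r<y
  ... | no  y≤r with y ≟ r
  ...   | yes refl = trans (mnTerm-blocked X′ (suc y) μ (suc y) ≤-refl (n∸n≡0 y) (here refl))
                           (sym (mnTerm-low X (suc y) μ y (n<1+n y)))
  ...   | no  y≢r  = trans (mnTerm-low X′ (suc r) μ (suc y) (s<s (≤∧≢⇒< (m<1+n⇒m≤n (≰⇒> y≤r)) y≢r)))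
                           (sym (mnTerm-low X (suc r) μ y (≰⇒> y≤r)))

downFrom-suc : ∀ p → downFrom (suc p) ≡ map suc (downFrom p) ∷ʳ 0
downFrom-suc zero    = refl
downFrom-suc (suc p) = cong (suc p ∷_) (downFrom-suc p)

downFrom-column : ∀ p → downFrom (suc p) ≡ column p ∷ʳ 0
downFrom-column zero    = refl
downFrom-column (suc p) = cong (suc p ∷_) (downFrom-column p)

chiβ-addBeads : ∀ o X μ → AllPos μ → chiβ (map (_+ o) X ++ downFrom o) μ ≡ chiβ X μ
chiβ-addBeads zero X μ _ =
  cong (λ L → chiβ L μ) (trans (++-identityʳ _) (trans (map-cong +-identityʳ X) (map-id X)))
chiβ-addBeads (suc p) X μ μ⁺ = begin
  chiβ (map (_+ suc p) X ++ downFrom (suc p)) μ ≡⟨ cong (λ L → chiβ L μ) beads ⟩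
  chiβ (map suc Y ∷ʳ 0) μ                       ≡⟨ chiβ-↭ μ (↭-sym (∷↭∷ʳ 0 (map suc Y))) ⟩
  chiβ (0 ∷ map suc Y) μ                        ≡⟨ chiβ-shift μ Y μ⁺ ⟩
  chiβ Y μ                                      ≡⟨ chiβ-addBeads p X μ μ⁺ ⟩
  chiβ X μ                                      ∎
  where
  open ≡-Reasoning
  Y = map (_+ p) X ++ downFrom p
  beads : map (_+ suc p) X ++ downFrom (suc p) ≡ map suc Y ∷ʳ 0
  beads = begin
    map (_+ suc p) X ++ downFrom (suc p)
      ≡⟨ cong₂ _++_ (trans (map-cong (λ x → +-suc x p) X) (map-∘ X)) (downFrom-suc p) ⟩
    map suc (map (_+ p) X) ++ (map suc (downFrom p) ∷ʳ 0)
      ≡⟨ ++-assoc (map suc (map (_+ p) X)) (map suc (downFrom p)) (0 ∷ []) ⟨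
    (map suc (map (_+ p) X) ++ map suc (downFrom p)) ∷ʳ 0
      ≡⟨ cong (_∷ʳ 0) (map-++ suc (map (_+ p) X) (downFrom p)) ⟨
    map suc Y ∷ʳ 0 ∎

replaceBead-column : ∀ N p →
  replaceBead (suc p) 0 (column (N + suc p)) ≡ map (_+ suc p) (column N) ++ (0 ∷ column p)
replaceBead-column zero    p rewrite ≡ᵇ-true {p} refl = refl
replaceBead-column (suc N) p rewrite ≡ᵇ-false {suc p} {suc (N + suc p)} (<⇒≢ (s≤s (m≤n+m (suc p) N))) =
  cong (suc (N + suc p) ∷_) (replaceBead-column N p)

-- replaceBead o 0 (column (N + o)) is {0, …, o − 1} ∪ {o + 1, …, o + N}, and a full bottom
-- segment of beads can be dropped.
chiβ-shiftDown : ∀ A B N o μ → AllPos μ → 1 ≤ o → o ≤ A → o ≤ B →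
  chiβ (A ∷ B ∷ replaceBead o 0 (column (N + o))) μ ≡ chiβ ((A ∸ o) ∷ (B ∸ o) ∷ column N) μ
chiβ-shiftDown A B N (suc p) μ μ⁺ _ o≤A o≤B = begin
  chiβ (A ∷ B ∷ replaceBead (suc p) 0 (column (N + suc p))) μ
    ≡⟨ cong (λ L → chiβ (A ∷ B ∷ L) μ) (replaceBead-column N p) ⟩
  chiβ (A ∷ B ∷ map (_+ suc p) (column N) ++ (0 ∷ column p)) μ
    ≡⟨ chiβ-↭ μ beads ⟩
  chiβ (map (_+ suc p) Z ++ downFrom (suc p)) μ
    ≡⟨ chiβ-addBeads (suc p) Z μ μ⁺ ⟩
  chiβ Z μ ∎
  where
  open ≡-Reasoning
  Z = (A ∸ suc p) ∷ (B ∸ suc p) ∷ column N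
  beads : (A ∷ B ∷ map (_+ suc p) (column N) ++ (0 ∷ column p)) ↭ (map (_+ suc p) Z ++ downFrom (suc p))
  beads rewrite m∸n+n≡m o≤A | m∸n+n≡m o≤B | downFrom-column p =
    prep A (prep B (++⁺ˡ (map (_+ suc p) (column N)) (∷↭∷ʳ 0 (column p))))

-- Removing one rim hook

chiβ-twoBeads : ∀ u v N r μ {a b} →
  mnTerm (u ∷ v ∷ column N) r μ u ≡ a → mnTerm (u ∷ v ∷ column N) r μ v ≡ b →
  Σℤ (mnTerm (u ∷ v ∷ column N) r μ) (column N) ≡ + 0 →
  chiβ (u ∷ v ∷ column N) (r ∷ μ) ≡ a ℤ.+ b
chiβ-twoBeads u v N r μ {a} {b} eu ev ecol =
  trans (cong₂ ℤ._+_ eu (cong₂ ℤ._+_ ev ecol)) (cong (ℤ._+_ a) (ℤP.+-identityʳ b))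

chiβ-oneRow : ∀ μ N → AllPos μ → chiβ ((suc N + sum μ) ∷ 0 ∷ column N) μ ≡ + 1
chiβ-oneRow [] N _ rewrite length-column N | +-identityʳ N | <ᵇ-true (n<1+n N)
                         | all-column N (suc (suc N)) (<-trans (n<1+n N) (n<1+n (suc N))) = refl
chiβ-oneRow (c ∷ μ) N (1≤c ∷ μ⁺) = chiβ-twoBeads D 0 N c μ top (mnTerm-low X c μ 0 1≤c) stuck
  where
  D  = suc N + (c + sum μ)
  D′ = suc N + sum μ
  X  = D ∷ 0 ∷ column N
  N<D′ : N < D′
  N<D′ = s≤s (m≤m+n N (sum μ))
  D′∉X : D′ ∉ X
  D′∉X = ∉-∷ (<⇒≢ (+-monoʳ-< (suc N) (m<n+m (sum μ) 1≤c))) (∉-∷ (λ ()) (∉-column N N<D′))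
  c≤D : c ≤ D
  c≤D = ≤-trans (m≤m+n c (sum μ)) (m≤n+m (c + sum μ) (suc N))
  D∸c : D ∸ c ≡ D′
  D∸c = trans (cong (_∸ c) (trans (cong (_+_ (suc N)) (+-comm c (sum μ))) (sym (+-assoc (suc N) (sum μ) c))))
              (m+n∸n≡m D′ c)
  leg : legLen D′ D X ≡ 0
  leg = trans (legLen-∷-above {D′} {D} (0 ∷ column N) ≤-refl)
    (trans (legLen-∷-out {z = 0} (column N) (λ { (() , _) })) (legLen-column-low D′ D N (<⇒≤ N<D′)))
  top : mnTerm X c μ D ≡ + 1
  top = begin
    mnTerm X c μ D
      ≡⟨ mnTerm-move X c μ D c≤D D∸c D′∉X ⟩
    sgn (legLen D′ D X) ℤ.* chiβ (replaceBead D D′ X) μ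
      ≡⟨ cong₂ (λ l L → sgn l ℤ.* chiβ L μ) leg (replaceBead-head D D′ _) ⟩
    + 1 ℤ.* chiβ (D′ ∷ 0 ∷ column N) μ
      ≡⟨ ℤP.*-identityˡ _ ⟩
    chiβ (D′ ∷ 0 ∷ column N) μ
      ≡⟨ chiβ-oneRow μ N μ⁺ ⟩
    + 1 ∎
    where open ≡-Reasoning
  stuck : Σℤ (mnTerm X c μ) (column N) ≡ + 0
  stuck = Σℤ-column-zero _ N λ y _ y≤N → column-term y y≤N
    where
    column-term : ∀ y → y ≤ N → mnTerm X c μ y ≡ + 0
    column-term y y≤N with c ≤? y
    ... | yes c≤y = mnTerm-blocked X c μ y c≤y refl (there (∈-0∷column N (≤-trans (m∸n≤m y c) y≤N)))
    ... | no  c≰y = mnTerm-low X c μ y (≰⇒> c≰y)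

mnTerm-top : ∀ c v d N μ → 1 ≤ c → d < c + v → N < v → v ≢ d →
  mnTerm ((c + v) ∷ d ∷ column N) c μ (c + v) ≡ sgn (crossing v d) ℤ.* chiβ (v ∷ d ∷ column N) μ
mnTerm-top c v d N μ 1≤c d<c+v N<v v≢d =
  trans (mnTerm-move X c μ (c + v) (m≤m+n c v) (m+n∸m≡n c v) v∉X)
        (cong₂ (λ l L → sgn l ℤ.* chiβ L μ) (legLen-top v (c + v) d N d<c+v (<⇒≤ N<v))
                                           (replaceBead-head (c + v) v _))
  where
  X = (c + v) ∷ d ∷ column N
  v∉X : v ∉ X
  v∉X = ∉-∷ (<⇒≢ (m<n+m v 1≤c)) (∉-∷ v≢d (∉-column N N<v))

mnTerm-top-vanish : ∀ c v d N μ → 1 ≤ c → d < c + v → N < v →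
  (v ≢ d → chiβ (v ∷ d ∷ column N) μ ≡ + 0) → mnTerm ((c + v) ∷ d ∷ column N) c μ (c + v) ≡ + 0
mnTerm-top-vanish c v d N μ 1≤c d<c+v N<v vanish with v ≟ d
... | yes refl = mnTerm-blocked _ c μ (c + v) (m≤m+n c v) (m+n∸m≡n c v) (there (here refl))
... | no  v≢d  = trans (mnTerm-top c v d N μ 1≤c d<c+v N<v v≢d)
                       (trans (cong (sgn (crossing v d) ℤ.*_) (vanish v≢d)) (ℤP.*-zeroʳ (sgn (crossing v d))))

mnTerm-toZero : ∀ a d N μ → AllPos μ → N < a → a < d → d ≡ suc N + sum μ →
  mnTerm (a ∷ d ∷ column N) a μ a ≡ sgn N
mnTerm-toZero a d N μ μ⁺ N<a a<d d≡ = begin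
  mnTerm X a μ a
    ≡⟨ mnTerm-move X a μ a ≤-refl (n∸n≡0 a) 0∉X ⟩
  sgn (legLen 0 a X) ℤ.* chiβ (replaceBead a 0 X) μ
    ≡⟨ cong₂ (λ l L → sgn l ℤ.* chiβ L μ) leg (replaceBead-head a 0 _) ⟩
  sgn N ℤ.* chiβ (0 ∷ d ∷ column N) μ
    ≡⟨ cong (sgn N ℤ.*_) (chiβ-↭ μ (swap 0 d ↭-refl)) ⟩
  sgn N ℤ.* chiβ (d ∷ 0 ∷ column N) μ
    ≡⟨ cong (λ D → sgn N ℤ.* chiβ (D ∷ 0 ∷ column N) μ) d≡ ⟩
  sgn N ℤ.* chiβ ((suc N + sum μ) ∷ 0 ∷ column N) μ
    ≡⟨ cong (sgn N ℤ.*_) (chiβ-oneRow μ N μ⁺) ⟩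
  sgn N ℤ.* + 1
    ≡⟨ ℤP.*-identityʳ (sgn N) ⟩
  sgn N ∎
  where
  open ≡-Reasoning
  X = a ∷ d ∷ column N
  1≤a : 1 ≤ a
  1≤a = ≤-trans (s≤s z≤n) N<a
  0∉X : 0 ∉ X
  0∉X = ∉-∷ (<⇒≢ 1≤a) (∉-∷ (<⇒≢ (<-trans 1≤a a<d)) (0∉column N))
  leg : legLen 0 a X ≡ N
  leg = trans (legLen-∷-above {0} (d ∷ column N) ≤-refl)
              (trans (legLen-∷-above {0} (column N) (<⇒≤ a<d)) (legLen-column-inside a N N<a))

chiβ-removeTop : ∀ c v d N μ → d < c → N < d → N < v → v ≢ d →
  chiβ ((c + v) ∷ d ∷ column N) (c ∷ μ) ≡ sgn (crossing v d) ℤ.* chiβ (v ∷ d ∷ column N) μ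
chiβ-removeTop c v d N μ d<c N<d N<v v≢d = trans
  (chiβ-twoBeads (c + v) d N c μ
    (mnTerm-top c v d N μ (≤-trans (s≤s z≤n) d<c) (<-≤-trans d<c (m≤m+n c v)) N<v v≢d)
    (mnTerm-low _ c μ d d<c) (mnTerm-column-low _ c μ N (<-trans N<d d<c)))
  (ℤP.+-identityʳ _)

chiβ-removeFirstPart : ∀ a w N μ → AllPos μ → N < a → N < w → a + w ≡ suc N + sum μ →
  chiβ ((a + w) ∷ a ∷ column N) (a ∷ μ) ≡ mnTerm ((a + w) ∷ a ∷ column N) a μ (a + w) ℤ.+ sgn N
chiβ-removeFirstPart a w N μ μ⁺ N<a N<w a+w≡ = chiβ-twoBeads (a + w) a N a μ refl
  (trans (mnTerm-↭ a μ a (swap (a + w) a ↭-refl)) (mnTerm-toZero a (a + w) N μ μ⁺ N<a a<a+w a+w≡))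
  (mnTerm-column-low _ a μ N N<a)
  where
  a<a+w : a < a + w
  a<a+w = m<m+n a (≤-trans (s≤s z≤n) N<w)

chiβ-removeFirstPart-sgn : ∀ a w N μ → AllPos μ → N < a → N < w → a + w ≡ suc N + sum μ →
  (w ≢ a → chiβ (w ∷ a ∷ column N) μ ≡ + 0) → chiβ (a ∷ (a + w) ∷ column N) (a ∷ μ) ≡ sgn N
chiβ-removeFirstPart-sgn a w N μ μ⁺ N<a N<w a+w≡ vanish = begin
  chiβ (a ∷ (a + w) ∷ column N) (a ∷ μ)
    ≡⟨ chiβ-↭ (a ∷ μ) (swap a (a + w) ↭-refl) ⟩
  chiβ ((a + w) ∷ a ∷ column N) (a ∷ μ)
    ≡⟨ chiβ-removeFirstPart a w N μ μ⁺ N<a N<w a+w≡ ⟩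
  mnTerm ((a + w) ∷ a ∷ column N) a μ (a + w) ℤ.+ sgn N
    ≡⟨ cong (ℤ._+ sgn N) top ⟩
  + 0 ℤ.+ sgn N
    ≡⟨ ℤP.+-identityˡ (sgn N) ⟩
  sgn N ∎
  where
  open ≡-Reasoning
  top : mnTerm ((a + w) ∷ a ∷ column N) a μ (a + w) ≡ + 0
  top = mnTerm-top-vanish a w a N μ (≤-trans (s≤s z≤n) N<a) (m<m+n a (≤-trans (s≤s z≤n) N<w)) N<w vanish

chiβ-removeSecondPart : ∀ w a b N μ → 1 ≤ b → b ≤ N → b < w → w ∸ b ≤ N → b < a → a ∸ b ≤ N →
  chiβ (w ∷ a ∷ column N) (b ∷ μ) ≡ sgn (b ∸ 1) ℤ.* chiβ (w ∷ a ∷ replaceBead b 0 (column N)) μ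
chiβ-removeSecondPart w a b N μ 1≤b b≤N b<w w∸b≤N b<a a∸b≤N =
  trans (cong₂ ℤ._+_ (blocked w b<w w∸b≤N) (cong₂ ℤ._+_ (blocked a b<a a∸b≤N) column-sum))
        (trans (ℤP.+-identityˡ _) (ℤP.+-identityˡ _))
  where
  X = w ∷ a ∷ column N
  blocked : ∀ y → b < y → y ∸ b ≤ N → mnTerm X b μ y ≡ + 0
  blocked y b<y y∸b≤N =
    mnTerm-blocked X b μ y (<⇒≤ b<y) refl (there (there (∈-column N (m<n⇒0<n∸m b<y) y∸b≤N)))
  stuck : ∀ y → 1 ≤ y → y ≤ N → y ≢ b → mnTerm X b μ y ≡ + 0
  stuck y _ y≤N y≢b with y <? b
  ... | yes y<b = mnTerm-low X b μ y y<b
  ... | no  y≮b = blocked y (≤∧≢⇒< (≮⇒≥ y≮b) (y≢b ∘ sym)) (≤-trans (m∸n≤m y b) y≤N)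
  0∉X : 0 ∉ X
  0∉X = ∉-∷ (<⇒≢ (<-trans 1≤b b<w)) (∉-∷ (<⇒≢ (<-trans 1≤b b<a)) (0∉column N))
  leg : legLen 0 b X ≡ b ∸ 1
  leg = trans (legLen-∷-above {0} (a ∷ column N) (<⇒≤ b<w))
              (trans (legLen-∷-above {0} (column N) (<⇒≤ b<a)) (legLen-column-cut b N 1≤b b≤N))
  column-sum : Σℤ (mnTerm X b μ) (column N) ≡ sgn (b ∸ 1) ℤ.* chiβ (w ∷ a ∷ replaceBead b 0 (column N)) μ
  column-sum = begin
    Σℤ (mnTerm X b μ) (column N)                        ≡⟨ Σℤ-column-single _ N b 1≤b b≤N stuck ⟩
    mnTerm X b μ b                                      ≡⟨ mnTerm-move X b μ b ≤-refl (n∸n≡0 b) 0∉X ⟩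
    sgn (legLen 0 b X) ℤ.* chiβ (replaceBead b 0 X) μ    ≡⟨ cong₂ (λ l L → sgn l ℤ.* chiβ L μ) leg replaced ⟩
    sgn (b ∸ 1) ℤ.* chiβ (w ∷ a ∷ replaceBead b 0 (column N)) μ ∎
    where
    open ≡-Reasoning
    replaced : replaceBead b 0 X ≡ w ∷ a ∷ replaceBead b 0 (column N)
    replaced = trans (replaceBead-∷ 0 _ (<⇒≢ b<w)) (cong (w ∷_) (replaceBead-∷ 0 _ (<⇒≢ b<a)))

chiβ-stripSecondPart : ∀ b u d N μ → AllPos μ → 1 ≤ b → 1 ≤ u → 1 ≤ d → u ≤ b + N → d ≤ b + N →
  chiβ ((b + u) ∷ (b + d) ∷ column (b + N)) (b ∷ μ) ≡ sgn (b ∸ 1) ℤ.* chiβ (u ∷ d ∷ column N) μ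
chiβ-stripSecondPart b u d N μ μ⁺ 1≤b 1≤u 1≤d u≤ d≤ = begin
  chiβ ((b + u) ∷ (b + d) ∷ column (b + N)) (b ∷ μ)
    ≡⟨ chiβ-removeSecondPart (b + u) (b + d) b (b + N) μ 1≤b (m≤m+n b N) (m<m+n b 1≤u)
         (subst (_≤ b + N) (sym (m+n∸m≡n b u)) u≤) (m<m+n b 1≤d) (subst (_≤ b + N) (sym (m+n∸m≡n b d)) d≤) ⟩
  sgn (b ∸ 1) ℤ.* chiβ ((b + u) ∷ (b + d) ∷ replaceBead b 0 (column (b + N))) μ
    ≡⟨ cong (sgn (b ∸ 1) ℤ.*_) stripped ⟩
  sgn (b ∸ 1) ℤ.* chiβ (u ∷ d ∷ column N) μ ∎
  where
  open ≡-Reasoning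
  stripped : chiβ ((b + u) ∷ (b + d) ∷ replaceBead b 0 (column (b + N))) μ ≡ chiβ (u ∷ d ∷ column N) μ
  stripped = begin
    chiβ ((b + u) ∷ (b + d) ∷ replaceBead b 0 (column (b + N))) μ
      ≡⟨ cong (λ n → chiβ ((b + u) ∷ (b + d) ∷ replaceBead b 0 (column n)) μ) (+-comm b N) ⟩
    chiβ ((b + u) ∷ (b + d) ∷ replaceBead b 0 (column (N + b))) μ
      ≡⟨ chiβ-shiftDown (b + u) (b + d) N b μ μ⁺ 1≤b (m≤m+n b u) (m≤m+n b d) ⟩
    chiβ (((b + u) ∸ b) ∷ ((b + d) ∸ b) ∷ column N) μ
      ≡⟨ cong₂ (λ p q → chiβ (p ∷ q ∷ column N) μ) (m+n∸m≡n b u) (m+n∸m≡n b d) ⟩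
    chiβ (u ∷ d ∷ column N) μ ∎

-- The shapes (a, a − 1, 1) and (a, a − 1, t, 1)

-- {t + 1, 1} is a beta-set of (t, 1), and the standard character vanishes on a t-cycle.
chiβ-standard-vanish : ∀ t → 2 ≤ t → chiβ (suc t ∷ 1 ∷ []) (t ∷ 1 ∷ []) ≡ + 0
chiβ-standard-vanish t 2≤t =
  cong₂ ℤ._+_ (mnTerm-blocked X t μ (suc t) (n≤1+n t) (m+n∸n≡m 1 t) (there (here refl)))
              (cong₂ ℤ._+_ (mnTerm-low X t μ 1 2≤t) refl)
  where
  X = suc t ∷ 1 ∷ []
  μ = 1 ∷ []

chiβ-aa1-vanish : ∀ a′ N → suc N < a′ → chiβ (suc N ∷ suc a′ ∷ column N) (a′ ∷ 1 ∷ []) ≡ + 0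
chiβ-aa1-vanish a′ N sN<a′ = chiβ-twoBeads (suc N) (suc a′) N a′ (1 ∷ [])
  (mnTerm-low X a′ (1 ∷ []) (suc N) sN<a′)
  (mnTerm-blocked X a′ (1 ∷ []) (suc a′) (n≤1+n a′) (m+n∸n≡m 1 a′) (1∈ N))
  (mnTerm-column-low X a′ (1 ∷ []) N (<-trans (n<1+n N) sN<a′))
  where
  X = suc N ∷ suc a′ ∷ column N
  1∈ : ∀ N → 1 ∈ suc N ∷ suc a′ ∷ column N
  1∈ zero    = here refl
  1∈ (suc M) = there (there (∈-column (suc M) z<s (s≤s z≤n)))

chiβ-aa1 : ∀ a′ N → 1 ≤ a′ → N < suc a′ → suc N ≢ a′ →
  chiβ (suc a′ ∷ (suc a′ + suc N) ∷ column N) (suc a′ ∷ a′ ∷ 1 ∷ []) ≡ sgn N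
chiβ-aa1 a′ N 1≤a′ N<a sN≢a′ =
  chiβ-removeFirstPart-sgn (suc a′) (suc N) N (a′ ∷ 1 ∷ []) (1≤a′ ∷ z<s ∷ []) N<a (n<1+n N) total
    (λ sN≢a → chiβ-aa1-vanish a′ N (≤∧≢⇒< (≤∧≢⇒< (m<1+n⇒m≤n N<a) (sN≢a ∘ cong suc)) sN≢a′))
  where
  open ℕSolver
  total : suc a′ + suc N ≡ suc N + sum (a′ ∷ 1 ∷ [])
  total = solve 2 (λ a n → con 1 :+ a :+ (con 1 :+ n) := con 1 :+ n :+ (a :+ (con 1 :+ con 0))) refl a′ N

mnTerm-aat1-column : ∀ t a′ → 2 ≤ t → 1 ≤ a′ →
  mnTerm ((t + suc a′) ∷ suc a′ ∷ column a′) a′ (t ∷ 1 ∷ []) a′ ≡ + 0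
mnTerm-aat1-column t a′ 2≤t 1≤a′ = mnTerm-move-vanish X a′ ν a′ ≤-refl (n∸n≡0 a′) 0∉X (begin
  chiβ (replaceBead a′ 0 X) ν
    ≡⟨ cong (λ L → chiβ L ν) replaced ⟩
  chiβ (w ∷ suc a′ ∷ replaceBead a′ 0 (column a′)) ν
    ≡⟨ chiβ-shiftDown w (suc a′) 0 a′ ν ν⁺ 1≤a′ (<⇒≤ a′<w) (n≤1+n a′) ⟩
  chiβ ((w ∸ a′) ∷ (suc a′ ∸ a′) ∷ []) ν
    ≡⟨ cong₂ (λ p q → chiβ (p ∷ q ∷ []) ν) w∸a′ (m+n∸n≡m 1 a′) ⟩
  chiβ (suc t ∷ 1 ∷ []) ν
    ≡⟨ chiβ-standard-vanish t 2≤t ⟩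
  + 0 ∎)
  where
  open ≡-Reasoning
  ν = t ∷ 1 ∷ []
  ν⁺ : AllPos ν
  ν⁺ = ≤-trans (s≤s z≤n) 2≤t ∷ z<s ∷ []
  w = t + suc a′
  X = w ∷ suc a′ ∷ column a′
  a′<w : a′ < w
  a′<w = <-≤-trans (n<1+n a′) (m≤n+m (suc a′) t)
  w∸a′ : w ∸ a′ ≡ suc t
  w∸a′ = trans (cong (_∸ a′) (+-suc t a′)) (m+n∸n≡m (suc t) a′)
  0∉X : 0 ∉ X
  0∉X = ∉-∷ (<⇒≢ (≤-<-trans z≤n a′<w)) (∉-∷ (λ ()) (0∉column a′))
  replaced : replaceBead a′ 0 X ≡ w ∷ suc a′ ∷ replaceBead a′ 0 (column a′)
  replaced = trans (replaceBead-∷ 0 _ (<⇒≢ a′<w)) (cong (w ∷_) (replaceBead-∷ 0 _ (<⇒≢ (n<1+n a′))))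

chiβ-aat1-vanish : ∀ t a′ N → 2 ≤ t → suc t ≤ a′ → N ≤ a′ → t + suc N ≢ a′ →
  chiβ ((t + suc N) ∷ suc a′ ∷ column N) (a′ ∷ t ∷ 1 ∷ []) ≡ + 0
chiβ-aat1-vanish t a′ zero 2≤t t<a′ _ w≢a′ = chiβ-twoBeads (t + 1) (suc a′) 0 a′ ν
  (mnTerm-low X a′ ν (t + 1) (≤∧≢⇒< t+1≤a′ w≢a′))
  (mnTerm-move-vanish X a′ ν (suc a′) (n≤1+n a′) (m+n∸n≡m 1 a′) 1∉X
    (trans (cong (λ L → chiβ L ν) replaced) (chiβ-standard-vanish t 2≤t)))
  refl
  where
  ν = t ∷ 1 ∷ []
  X = (t + 1) ∷ suc a′ ∷ []
  t+1≡ : t + 1 ≡ suc t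
  t+1≡ = +-comm t 1
  t+1≤a′ : t + 1 ≤ a′
  t+1≤a′ = ≤-trans (≤-reflexive t+1≡) t<a′
  1∉X : 1 ∉ X
  1∉X = ∉-∷ (λ e → <⇒≢ (s≤s (≤-trans (s≤s z≤n) 2≤t)) (trans e t+1≡))
            (∉-∷ (<⇒≢ (s≤s (≤-trans (s≤s z≤n) t<a′))) λ ())
  replaced : replaceBead (suc a′) 1 X ≡ suc t ∷ 1 ∷ []
  replaced = trans (replaceBead-∷ 1 _ (λ e → <⇒≢ (s≤s t+1≤a′) (sym e)))
                   (cong₂ _∷_ t+1≡ (replaceBead-head (suc a′) 1 []))
chiβ-aat1-vanish t a′ (suc M) 2≤t t<a′ N≤a′ w≢a′ =
  chiβ-twoBeads w (suc a′) (suc M) a′ ν first second column-stuck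
  where
  ν = t ∷ 1 ∷ []
  w = t + suc (suc M)
  X = w ∷ suc a′ ∷ column (suc M)
  inColumn : ∀ {z} → 1 ≤ z → z ≤ suc M → z ∈ X
  inColumn 1≤z z≤N = there (there (∈-column (suc M) 1≤z z≤N))
  first : mnTerm X a′ ν w ≡ + 0
  first with w <? a′
  ... | yes w<a′ = mnTerm-low X a′ ν w w<a′
  ... | no  w≮a′ = mnTerm-blocked X a′ ν w (<⇒≤ a′<w) refl (inColumn (m<n⇒0<n∸m a′<w) w∸a′≤N)
    where
    a′<w : a′ < w
    a′<w = ≤∧≢⇒< (≮⇒≥ w≮a′) (w≢a′ ∘ sym)
    w∸a′≤N : w ∸ a′ ≤ suc M
    w∸a′≤N = ≤-trans (∸-monoˡ-≤ a′ (≤-trans (≤-reflexive (+-suc t (suc M))) (+-monoˡ-≤ (suc M) t<a′)))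
                     (≤-reflexive (m+n∸m≡n a′ (suc M)))
  second : mnTerm X a′ ν (suc a′) ≡ + 0
  second = mnTerm-blocked X a′ ν (suc a′) (n≤1+n a′) (m+n∸n≡m 1 a′) (inColumn z<s (s≤s z≤n))
  column-stuck : Σℤ (mnTerm X a′ ν) (column (suc M)) ≡ + 0
  column-stuck = Σℤ-column-zero _ (suc M) term
    where
    term : ∀ y → 1 ≤ y → y ≤ suc M → mnTerm X a′ ν y ≡ + 0
    term y _ y≤N with y <? a′
    ... | yes y<a′ = mnTerm-low X a′ ν y y<a′
    ... | no  y≮a′ with ≤-antisym (≮⇒≥ y≮a′) (≤-trans y≤N N≤a′) | ≤-antisym N≤a′ (≤-trans (≮⇒≥ y≮a′) y≤N)
    ...   | refl | refl = mnTerm-aat1-column t (suc M) 2≤t z<s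

chiβ-aat1 : ∀ t a′ N → 2 ≤ t → suc t ≤ a′ → N ≤ a′ → t + suc N ≢ a′ →
  chiβ (suc a′ ∷ (suc a′ + (t + suc N)) ∷ column N) (suc a′ ∷ a′ ∷ t ∷ 1 ∷ []) ≡ sgn N
chiβ-aat1 t a′ N 2≤t t<a′ N≤a′ w≢a′ =
  chiβ-removeFirstPart-sgn (suc a′) (t + suc N) N (a′ ∷ t ∷ 1 ∷ []) (1≤a′ ∷ 1≤t ∷ z<s ∷ []) (s≤s N≤a′)
    (<-≤-trans (n<1+n N) (m≤n+m (suc N) t))
    total (λ _ → chiβ-aat1-vanish t a′ N 2≤t t<a′ N≤a′ w≢a′)
  where
  open ℕSolver
  total : suc a′ + (t + suc N) ≡ suc N + sum (a′ ∷ t ∷ 1 ∷ [])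
  total = solve 3 (λ a t n → con 1 :+ a :+ (t :+ (con 1 :+ n)) := con 1 :+ n :+ (a :+ (t :+ (con 1 :+ con 0))))
                refl a′ t N
  1≤t : 1 ≤ t
  1≤t = ≤-trans (s≤s z≤n) 2≤t
  1≤a′ : 1 ≤ a′
  1≤a′ = ≤-trans (s≤s z≤n) t<a′

-- The residual character along Sign

ExceptionalFor : List ℕ → ℕ → ℕ → Set
ExceptionalFor seg a₁ a₂ =
    (seg ≡ 3 ∷ 2 ∷ 1 ∷ 1 ∷ [] × a₁ ≡ a₂ + sum seg)
  ⊎ (seg ≡ 5 ∷ 3 ∷ 2 ∷ 1 ∷ [] × a₁ ≡ a₂ + sum seg)
  ⊎ (∃[ a ] (2 ≤ a × seg ≡ a ∷ (a ∸ 1) ∷ 1 ∷ [] × a₁ ≡ (a₂ + sum seg) ∸ 1))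
  ⊎ (∃[ a ] (4 ≤ a × seg ≡ a ∷ (a ∸ 1) ∷ 2 ∷ 1 ∷ [] × a₁ ≡ (a₂ + sum seg) ∸ 3))
  ⊎ (∃[ a ] (5 ≤ a × seg ≡ a ∷ (a ∸ 1) ∷ 3 ∷ 1 ∷ [] × a₁ ≡ (a₂ + sum seg) ∸ 4))

-- The case α₂ = 0, so that d plays the role of α₁ − α₂.
Exceptional : List ℕ → ℕ → Set
Exceptional seg d = ExceptionalFor seg d 0

ExceptionalFor-shift : ∀ {seg d} a₂ → Exceptional seg d → ExceptionalFor seg (a₂ + d) a₂
ExceptionalFor-shift a₂ (inj₁ (p , q)) = inj₁ (p , cong (_+_ a₂) q)
ExceptionalFor-shift a₂ (inj₂ (inj₁ (p , q))) = inj₂ (inj₁ (p , cong (_+_ a₂) q))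
ExceptionalFor-shift a₂ (inj₂ (inj₂ (inj₁ (a , 2≤a , p , q)))) =
  inj₂ (inj₂ (inj₁ (a , 2≤a , p , +-∸-shift a₂ 1 (<head⇒≤sum _ 2≤a p) q)))
ExceptionalFor-shift a₂ (inj₂ (inj₂ (inj₂ (inj₁ (a , 4≤a , p , q))))) =
  inj₂ (inj₂ (inj₂ (inj₁ (a , 4≤a , p , +-∸-shift a₂ 3 (<head⇒≤sum _ 4≤a p) q))))
ExceptionalFor-shift a₂ (inj₂ (inj₂ (inj₂ (inj₂ (a , 5≤a , p , q))))) =
  inj₂ (inj₂ (inj₂ (inj₂ (a , 5≤a , p , +-∸-shift a₂ 4 (<head⇒≤sum _ 5≤a p) q))))

-- {|μ| − x, x + N + 1, N, …, 1} is a beta-set of (|μ| − x − N − 1, x + 1, 1^N), with its two top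
-- beads possibly out of order; crossing records the sign of reordering them.
ResidualValue : List ℕ → ℕ → ℕ → Set
ResidualValue μ x N =
  sum μ ∸ x ≢ x + suc N ×
  chiβ ((sum μ ∸ x) ∷ (x + suc N) ∷ column N) μ ≡ sgn (crossing (sum μ ∸ x) (x + suc N)) ℤ.* sgn (suc N)

Residual : List ℕ → ℕ → List ℕ → ℕ → Set
Residual μ e ρ N = sum ρ + suc N ∉ μ → ¬ Exceptional (e ∷ ρ) (sum ρ + suc N) → ResidualValue μ (sum ρ) N

AllResiduals : List ℕ → Set
AllResiduals γ = ∀ j e ρ → drop j γ ≡ e ∷ ρ → e ≤ sum ρ → ∀ N → N < e → Residual γ e ρ N

exceptional-value : ∀ t N x → suc (t + suc N) + x ∸ suc t ≡ x + suc N
exceptional-value t N x =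
  trans (cong (_∸ suc t) (+-assoc (suc t) (suc N) x)) (trans (m+n∸m≡n (suc t) (suc N + x)) (+-comm (suc N) x))

residualValue-aa1 : ∀ a′ N → 1 ≤ a′ → N < suc a′ → sum (a′ ∷ 1 ∷ []) + suc N ≢ sum (suc a′ ∷ a′ ∷ 1 ∷ []) ∸ 1 →
  ResidualValue (suc a′ ∷ a′ ∷ 1 ∷ []) (sum (a′ ∷ 1 ∷ [])) N
residualValue-aa1 a′ N 1≤a′ N<a not-exceptional = <⇒≢ a<d ∘ trans (sym top) , (begin
  chiβ ((sum γ ∸ x) ∷ (x + suc N) ∷ column N) γ
    ≡⟨ cong₂ (λ u d → chiβ (u ∷ d ∷ column N) γ) top (cong (_+ suc N) x≡) ⟩
  chiβ (suc a′ ∷ (suc a′ + suc N) ∷ column N) γ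
    ≡⟨ chiβ-aa1 a′ N 1≤a′ N<a sN≢a′ ⟩
  sgn N
    ≡⟨ sgn-crossing-below N (subst (_< x + suc N) (sym top) a<d) ⟨
  sgn (crossing (sum γ ∸ x) (x + suc N)) ℤ.* sgn (suc N) ∎)
  where
  open ≡-Reasoning
  γ = suc a′ ∷ a′ ∷ 1 ∷ []
  x = sum (a′ ∷ 1 ∷ [])
  x≡ : x ≡ suc a′
  x≡ = +-comm a′ 1
  top : sum γ ∸ x ≡ suc a′
  top = m+n∸n≡m (suc a′) x
  a<d : suc a′ < x + suc N
  a<d = subst (_< x + suc N) x≡ (m<m+n x z<s)
  sN≢a′ : suc N ≢ a′
  sN≢a′ refl = not-exceptional (sym (exceptional-value 0 N x))

residualValue-aat1 : ∀ t a′ N → 2 ≤ t → suc t ≤ a′ → N < suc a′ →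
  sum (a′ ∷ t ∷ 1 ∷ []) + suc N ≢ sum (suc a′ ∷ a′ ∷ t ∷ 1 ∷ []) ∸ suc t →
  ResidualValue (suc a′ ∷ a′ ∷ t ∷ 1 ∷ []) (sum (a′ ∷ t ∷ 1 ∷ [])) N
residualValue-aat1 t a′ N 2≤t t<a′ N<a not-exceptional = <⇒≢ a<d ∘ trans (sym top) , (begin
  chiβ ((sum γ ∸ x) ∷ (x + suc N) ∷ column N) γ
    ≡⟨ cong₂ (λ u d → chiβ (u ∷ d ∷ column N) γ) top d≡ ⟩
  chiβ (suc a′ ∷ (suc a′ + (t + suc N)) ∷ column N) γ
    ≡⟨ chiβ-aat1 t a′ N 2≤t t<a′ (m<1+n⇒m≤n N<a) w≢a′ ⟩
  sgn N
    ≡⟨ sgn-crossing-below N (subst (_< x + suc N) (sym top) a<d) ⟨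
  sgn (crossing (sum γ ∸ x) (x + suc N)) ℤ.* sgn (suc N) ∎)
  where
  open ≡-Reasoning
  γ = suc a′ ∷ a′ ∷ t ∷ 1 ∷ []
  x = sum (a′ ∷ t ∷ 1 ∷ [])
  d≡ : x + suc N ≡ suc a′ + (t + suc N)
  d≡ = solve 3 (λ a t n → a :+ (t :+ (con 1 :+ con 0)) :+ (con 1 :+ n) := con 1 :+ a :+ (t :+ (con 1 :+ n)))
             refl a′ t N
    where open ℕSolver
  top : sum γ ∸ x ≡ suc a′
  top = m+n∸n≡m (suc a′) x
  a<d : suc a′ < x + suc N
  a<d = subst (suc a′ <_) (sym d≡) (m<m+n (suc a′) (≤-trans (s≤s z≤n) (m≤n+m (suc N) t)))
  w≢a′ : t + suc N ≢ a′
  w≢a′ refl = not-exceptional (sym (exceptional-value t N x))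

residual-11 : AllResiduals (1 ∷ 1 ∷ [])
residual-11 0 _ _ refl _ N N<e = All.lookup cases (∈-upTo⁺ N<e)
  where
  cases : All (Residual (1 ∷ 1 ∷ []) 1 (1 ∷ [])) (upTo 1)
  cases = (λ _ _ → (λ ()) , refl) ∷ []
residual-11 1 _ _ refl () _ _
residual-11 2 _ _ () _ _ _
residual-11 (suc (suc (suc j))) _ _ () _ _ _

residual-3211 : AllResiduals (3 ∷ 2 ∷ 1 ∷ 1 ∷ [])
residual-3211 0 _ _ refl _ N N<e = All.lookup cases (∈-upTo⁺ N<e)
  where
  cases : All (Residual (3 ∷ 2 ∷ 1 ∷ 1 ∷ []) 3 (2 ∷ 1 ∷ 1 ∷ [])) (upTo 3)
  cases = (λ _ _ → (λ ()) , refl) ∷ (λ _ _ → (λ ()) , refl) ∷ (λ _ ex → ⊥-elim (ex (inj₁ (refl , refl)))) ∷ []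
residual-3211 1 _ _ refl _ N N<e = All.lookup cases (∈-upTo⁺ N<e)
  where
  cases : All (Residual (3 ∷ 2 ∷ 1 ∷ 1 ∷ []) 2 (1 ∷ 1 ∷ [])) (upTo 2)
  cases = (λ d∉ _ → ⊥-elim (d∉ (here refl))) ∷ (λ _ _ → (λ ()) , refl) ∷ []
residual-3211 2 _ _ refl _ N N<e = All.lookup cases (∈-upTo⁺ N<e)
  where
  cases : All (Residual (3 ∷ 2 ∷ 1 ∷ 1 ∷ []) 1 (1 ∷ [])) (upTo 1)
  cases = (λ d∉ _ → ⊥-elim (d∉ (there (here refl)))) ∷ []
residual-3211 3 _ _ refl () _ _
residual-3211 4 _ _ () _ _ _
residual-3211 (suc (suc (suc (suc (suc j))))) _ _ () _ _ _

residual-5321 : AllResiduals (5 ∷ 3 ∷ 2 ∷ 1 ∷ [])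
residual-5321 0 _ _ refl _ N N<e = All.lookup cases (∈-upTo⁺ N<e)
  where
  cases : All (Residual (5 ∷ 3 ∷ 2 ∷ 1 ∷ []) 5 (3 ∷ 2 ∷ 1 ∷ [])) (upTo 5)
  cases = (λ _ _ → (λ ()) , refl) ∷ (λ _ _ → (λ ()) , refl) ∷ (λ _ _ → (λ ()) , refl) ∷ (λ _ _ → (λ ()) , refl)
        ∷ (λ _ ex → ⊥-elim (ex (inj₂ (inj₁ (refl , refl))))) ∷ []
residual-5321 1 _ _ refl _ N N<e = All.lookup cases (∈-upTo⁺ N<e)
  where
  cases : All (Residual (5 ∷ 3 ∷ 2 ∷ 1 ∷ []) 3 (2 ∷ 1 ∷ [])) (upTo 3)
  cases = (λ _ _ → (λ ()) , refl) ∷ (λ d∉ _ → ⊥-elim (d∉ (here refl))) ∷ (λ _ _ → (λ ()) , refl) ∷ []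
residual-5321 2 _ _ refl (s≤s ()) _ _
residual-5321 3 _ _ refl () _ _
residual-5321 4 _ _ () _ _ _
residual-5321 (suc (suc (suc (suc (suc j))))) _ _ () _ _ _

residual-aa1 : ∀ a → 2 ≤ a → AllResiduals (a ∷ (a ∸ 1) ∷ 1 ∷ [])
residual-aa1 (suc a′) (s≤s 1≤a′) 0 _ _ refl _ N N<e _ ex =
  residualValue-aa1 a′ N 1≤a′ N<e (λ q → ex (inj₂ (inj₂ (inj₁ (suc a′ , s≤s 1≤a′ , refl , q)))))
residual-aa1 _ (s≤s (s≤s _)) 1 _ _ refl (s≤s z≤n) 0 (s≤s z≤n) d∉ _ = ⊥-elim (d∉ (here refl))
residual-aa1 a _ 2 _ _ refl () _ _
residual-aa1 a _ 3 _ _ () _ _ _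
residual-aa1 a _ (suc (suc (suc (suc j)))) _ _ () _ _ _

residual-aa21 : ∀ a → 4 ≤ a → AllResiduals (a ∷ (a ∸ 1) ∷ 2 ∷ 1 ∷ [])
residual-aa21 (suc a′) (s≤s 3≤a′) 0 _ _ refl _ N N<e _ ex =
  residualValue-aat1 2 a′ N (s≤s (s≤s z≤n)) 3≤a′ N<e
    (λ q → ex (inj₂ (inj₂ (inj₂ (inj₁ (suc a′ , s≤s 3≤a′ , refl , q))))))
residual-aa21 _ (s≤s (s≤s (s≤s (s≤s _)))) 1 _ _ refl (s≤s (s≤s (s≤s z≤n))) N N<e =
  All.lookup cases (∈-upTo⁺ N<e)
  where
  cases : All (Residual (4 ∷ 3 ∷ 2 ∷ 1 ∷ []) 3 (2 ∷ 1 ∷ [])) (upTo 3)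
  cases = (λ d∉ _ → ⊥-elim (d∉ (here refl)))
        ∷ (λ _ ex → ⊥-elim (ex (inj₂ (inj₂ (inj₁ (3 , s≤s (s≤s z≤n) , refl , refl))))))
        ∷ (λ _ _ → (λ ()) , refl) ∷ []
residual-aa21 a _ 2 _ _ refl (s≤s ()) _ _
residual-aa21 a _ 3 _ _ refl () _ _
residual-aa21 a _ 4 _ _ () _ _ _
residual-aa21 a _ (suc (suc (suc (suc (suc j))))) _ _ () _ _ _

residual-aa31 : ∀ a → 5 ≤ a → AllResiduals (a ∷ (a ∸ 1) ∷ 3 ∷ 1 ∷ [])
residual-aa31 (suc a′) (s≤s 4≤a′) 0 _ _ refl _ N N<e _ ex =
  residualValue-aat1 3 a′ N (s≤s (s≤s z≤n)) 4≤a′ N<e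
    (λ q → ex (inj₂ (inj₂ (inj₂ (inj₂ (suc a′ , s≤s 4≤a′ , refl , q))))))
residual-aa31 _ (s≤s (s≤s (s≤s (s≤s (s≤s _))))) 1 _ _ refl (s≤s (s≤s (s≤s (s≤s z≤n)))) N N<e =
  All.lookup cases (∈-upTo⁺ N<e)
  where
  cases : All (Residual (5 ∷ 4 ∷ 3 ∷ 1 ∷ []) 4 (3 ∷ 1 ∷ [])) (upTo 4)
  cases = (λ d∉ _ → ⊥-elim (d∉ (here refl))) ∷ (λ _ _ → (λ ()) , refl)
        ∷ (λ _ ex → ⊥-elim (ex (inj₂ (inj₂ (inj₁ (4 , s≤s (s≤s z≤n) , refl , refl))))))
        ∷ (λ _ _ → (λ ()) , refl) ∷ []
residual-aa31 a _ 2 _ _ refl (s≤s ()) _ _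
residual-aa31 a _ 3 _ _ refl () _ _
residual-aa31 a _ 4 _ _ () _ _ _
residual-aa31 a _ (suc (suc (suc (suc (suc j))))) _ _ () _ _ _

residualValue-base : ∀ γ → SignBase γ → AllResiduals γ
residualValue-base _ sb-empty        zero    _ _ ()
residualValue-base _ sb-empty        (suc j) _ _ ()
residualValue-base _ sb-11           = residual-11
residualValue-base _ sb-3211         = residual-3211
residualValue-base _ sb-5321         = residual-5321
residualValue-base _ (sb-aa1 a 2≤a)  = residual-aa1 a 2≤a
residualValue-base _ (sb-aa21 a 4≤a) = residual-aa21 a 4≤a
residualValue-base _ (sb-aa31 a 5≤a) = residual-aa31 a 5≤a

residualValue : ∀ μ → SignShape μ → AllPos μ → AllResiduals μ
residualValue μ       (base b)          _        = residualValue-base μ b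
residualValue (c ∷ μ) (step c>Σ _)      _        zero    _ _ refl e≤x = ⊥-elim (<⇒≱ c>Σ e≤x)
residualValue (c ∷ μ) (step c>Σ shape) (_ ∷ μ⁺) (suc j) e ρ eq   e≤x N N<e d∉ ex = c+v≢d , (begin
  chiβ ((sum (c ∷ μ) ∸ x) ∷ d ∷ column N) (c ∷ μ)
    ≡⟨ cong (λ u → chiβ (u ∷ d ∷ column N) (c ∷ μ)) top≡ ⟩
  chiβ ((c + v) ∷ d ∷ column N) (c ∷ μ)
    ≡⟨ chiβ-removeTop c v d N μ d<c N<d N<v (proj₁ IH) ⟩
  sgn κ ℤ.* chiβ (v ∷ d ∷ column N) μ
    ≡⟨ cong (sgn κ ℤ.*_) (proj₂ IH) ⟩
  sgn κ ℤ.* (sgn κ ℤ.* sgn (suc N))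
    ≡⟨ ℤP.*-assoc (sgn κ) (sgn κ) (sgn (suc N)) ⟨
  sgn κ ℤ.* sgn κ ℤ.* sgn (suc N)
    ≡⟨ cong (ℤ._* sgn (suc N)) (sgn-square κ) ⟩
  + 1 ℤ.* sgn (suc N)
    ≡⟨ ℤP.*-identityˡ (sgn (suc N)) ⟩
  sgn (suc N)
    ≡⟨ sgn-crossing-above (sgn (suc N)) (≤-trans (<⇒≤ d<c) c≤top) ⟨
  sgn (crossing (sum (c ∷ μ) ∸ x) d) ℤ.* sgn (suc N) ∎)
  where
  open ≡-Reasoning
  x = sum ρ
  d = x + suc N
  v = sum μ ∸ x
  κ = crossing v d
  IH : ResidualValue μ x N
  IH = residualValue μ shape μ⁺ j e ρ eq e≤x N N<e (d∉ ∘ there) ex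
  e+x≤Σ : e + x ≤ sum μ
  e+x≤Σ = subst (_≤ sum μ) (cong sum eq) (sum-drop-≤ j μ)
  d≤Σ : d ≤ sum μ
  d≤Σ = ≤-trans (≤-trans (+-monoʳ-≤ x N<e) (≤-reflexive (+-comm x e))) e+x≤Σ
  d<c : d < c
  d<c = ≤-<-trans d≤Σ c>Σ
  N<d : N < d
  N<d = <-≤-trans (n<1+n N) (m≤n+m (suc N) x)
  N<v : N < v
  N<v = ≤-trans (≤-reflexive (sym (m+n∸m≡n x (suc N)))) (∸-monoˡ-≤ x d≤Σ)
  top≡ : sum (c ∷ μ) ∸ x ≡ c + v
  top≡ = +-∸-assoc c (m+n≤o⇒n≤o e e+x≤Σ)
  c≤top : c ≤ sum (c ∷ μ) ∸ x
  c≤top = ≤-trans (m≤m+n c v) (≤-reflexive (sym top≡))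
  c+v≢d : sum (c ∷ μ) ∸ x ≢ d
  c+v≢d e = <⇒≢ (<-≤-trans d<c c≤top) (sym e)

-- The partition β

betaSet-column : ∀ n → betaSet (replicate n 1) ≡ column n
betaSet-column zero    = refl
betaSet-column (suc n) = cong₂ _∷_ (cong suc (length-replicate n)) (betaSet-column n)

betaSet-hookShape : ∀ m y n → betaSet (m ∷ y ∷ replicate n 1) ≡ (m + suc n) ∷ (y + n) ∷ column n
betaSet-hookShape m y n = cong₂ _∷_ (cong (λ l → m + suc l) (length-replicate n))
                                    (cong₂ _∷_ (cong (_+_ y) (length-replicate n)) (betaSet-column n))

isPartition-hookShape : ∀ m y n → 1 ≤ y → y ≤ m → IsPartition (m ∷ y ∷ replicate n 1)
isPartition-hookShape m y n 1≤y y≤m = (y≤m ∷ nonIncreasing y n 1≤y) , (≤-trans 1≤y y≤m ∷ 1≤y ∷ positive n)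
  where
  nonIncreasing : ∀ b n → 1 ≤ b → NonIncr (b ∷ replicate n 1)
  nonIncreasing b zero    _   = [ b ]
  nonIncreasing b (suc n) 1≤b = 1≤b ∷ nonIncreasing 1 n ≤-refl
  positive : ∀ n → AllPos (replicate n 1)
  positive zero    = []
  positive (suc n) = z<s ∷ positive n

hook₂₁-hookShape : ∀ m y n → 1 ≤ y → y ≤ m → hook (m ∷ y ∷ replicate n 1) 2 1 ≡ (y ∸ 1) + n + 1
hook₂₁-hookShape m y n 1≤y y≤m
  rewrite filter-all (1 ≤?_) {xs = m ∷ y ∷ replicate n 1} (≤-trans 1≤y y≤m ∷ 1≤y ∷ Allₚ.replicate⁺ n ≤-refl)
        | length-replicate n {1} = refl

chiβ-removeFirstTwoParts : ∀ a₂ u d N μ → AllPos μ → N < u → u < a₂ → N < d → d ≤ a₂ + N → u ≢ d →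
  d + u ≡ suc N + sum μ → chiβ (u ∷ d ∷ column N) μ ≡ sgn (crossing u d) ℤ.* sgn (suc N) →
  chiβ ((a₂ + d + (a₂ + u)) ∷ (a₂ + d) ∷ column (a₂ + N)) ((a₂ + d) ∷ a₂ ∷ μ) ≡ + 2 ℤ.* sgn (a₂ + N)
chiβ-removeFirstTwoParts a₂ u d N μ μ⁺ N<u u<a₂ N<d d≤ u≢d total residual = begin
  chiβ ((a₁ + w) ∷ a₁ ∷ column N₀) (a₁ ∷ a₂ ∷ μ)
    ≡⟨ chiβ-removeFirstPart a₁ w N₀ (a₂ ∷ μ) (1≤a₂ ∷ μ⁺) (+-monoʳ-< a₂ N<d) N₀<w total₀ ⟩
  mnTerm ((a₁ + w) ∷ a₁ ∷ column N₀) a₁ (a₂ ∷ μ) (a₁ + w) ℤ.+ sgn N₀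
    ≡⟨ cong (ℤ._+ sgn N₀) top ⟩
  sgn (crossing w a₁) ℤ.* chiβ (w ∷ a₁ ∷ column N₀) (a₂ ∷ μ) ℤ.+ sgn N₀
    ≡⟨ cong (λ z → sgn (crossing w a₁) ℤ.* z ℤ.+ sgn N₀) strip ⟩
  sgn (crossing w a₁) ℤ.* (sgn (a₂ ∸ 1) ℤ.* chiβ (u ∷ d ∷ column N) μ) ℤ.+ sgn N₀
    ≡⟨ cong₂ (λ c z → sgn c ℤ.* (sgn (a₂ ∸ 1) ℤ.* z) ℤ.+ sgn N₀) (crossing-+ a₂ u d) residual ⟩
  sgn κ ℤ.* (sgn (a₂ ∸ 1) ℤ.* (sgn κ ℤ.* sgn (suc N))) ℤ.+ sgn N₀
    ≡⟨ cong (ℤ._+ sgn N₀) (κ*[s*[κ*n]]≡s*n (sgn κ) (sgn (a₂ ∸ 1)) (sgn (suc N)) (sgn-square κ)) ⟩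
  sgn (a₂ ∸ 1) ℤ.* sgn (suc N) ℤ.+ sgn N₀
    ≡⟨ cong (ℤ._+ sgn N₀) (trans (sym (sgn-+ (a₂ ∸ 1) (suc N))) (cong sgn exponent)) ⟩
  sgn N₀ ℤ.+ sgn N₀
    ≡⟨ i+i≡2*i (sgn N₀) ⟩
  + 2 ℤ.* sgn N₀ ∎
  where
  open ≡-Reasoning
  a₁ = a₂ + d
  w  = a₂ + u
  N₀ = a₂ + N
  κ  = crossing u d
  N₀<w : N₀ < w
  N₀<w = +-monoʳ-< a₂ N<u
  1≤a₂ : 1 ≤ a₂
  1≤a₂ = ≤-trans (s≤s z≤n) (≤-<-trans z≤n u<a₂)
  total₀ : a₁ + w ≡ suc N₀ + sum (a₂ ∷ μ)
  total₀ = begin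
    a₂ + d + (a₂ + u)
      ≡⟨ solve 3 (λ a d u → a :+ d :+ (a :+ u) := a :+ a :+ (d :+ u)) refl a₂ d u ⟩
    a₂ + a₂ + (d + u)
      ≡⟨ cong (_+_ (a₂ + a₂)) total ⟩
    a₂ + a₂ + (suc N + sum μ)
      ≡⟨ solve 3 (λ a n s → a :+ a :+ (con 1 :+ n :+ s) := con 1 :+ (a :+ n) :+ (a :+ s))
                 refl a₂ N (sum μ) ⟩
    suc N₀ + (a₂ + sum μ) ∎
    where open ℕSolver
  top : mnTerm ((a₁ + w) ∷ a₁ ∷ column N₀) a₁ (a₂ ∷ μ) (a₁ + w)
      ≡ sgn (crossing w a₁) ℤ.* chiβ (w ∷ a₁ ∷ column N₀) (a₂ ∷ μ)
  top = mnTerm-top a₁ w a₁ N₀ (a₂ ∷ μ) (≤-trans 1≤a₂ (m≤m+n a₂ d)) (m<m+n a₁ (≤-trans 1≤a₂ (m≤m+n a₂ u)))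
                   N₀<w (u≢d ∘ +-cancelˡ-≡ a₂ u d)
  strip : chiβ (w ∷ a₁ ∷ column N₀) (a₂ ∷ μ) ≡ sgn (a₂ ∸ 1) ℤ.* chiβ (u ∷ d ∷ column N) μ
  strip = chiβ-stripSecondPart a₂ u d N μ μ⁺ 1≤a₂ (≤-trans (s≤s z≤n) N<u) (≤-trans (s≤s z≤n) N<d)
                               (≤-trans (<⇒≤ u<a₂) (m≤m+n a₂ N)) d≤
  exponent : a₂ ∸ 1 + suc N ≡ N₀
  exponent = trans (+-suc (a₂ ∸ 1) N) (cong (_+ N) (suc-pred a₂ {{>-nonZero 1≤a₂}}))

HookShapeFacts : ℕ → ℕ → List ℕ → ℕ → Set
HookShapeFacts a₁ a₂ μ x =
  IsPartition β × hook β 2 1 ≡ a₁ × χ β (a₁ ∷ a₂ ∷ μ) ≡ + 2 ℤ.* sgn (a₁ ∸ x ∸ 1)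
  where β = (sum (a₁ ∷ a₂ ∷ μ) ∸ a₁) ∷ (x + 1) ∷ replicate (a₁ ∸ x ∸ 1) 1

hookShapeFacts : ∀ a₂ μ x N → AllPos μ → x + suc N ≤ sum μ → sum μ < a₂ → ResidualValue μ x N →
  HookShapeFacts (a₂ + (x + suc N)) a₂ μ x
hookShapeFacts a₂ μ x N μ⁺ d≤Σ Σ<a₂ (u≢d , residual) =
  isPartition-hookShape m (x + 1) n (m≤n+m 1 x) x+1≤m ,
  trans (hook₂₁-hookShape m (x + 1) n (m≤n+m 1 x) x+1≤m) hook-total ,
  (begin
    chiβ (betaSet (m ∷ (x + 1) ∷ replicate n 1)) α
      ≡⟨ cong (λ L → chiβ L α) (betaSet-hookShape m (x + 1) n) ⟩
    chiβ ((m + suc n) ∷ (x + 1 + n) ∷ column n) α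
      ≡⟨ cong (λ n → chiβ ((m + suc n) ∷ (x + 1 + n) ∷ column n) α) n≡ ⟩
    chiβ ((m + suc N₀) ∷ (x + 1 + N₀) ∷ column N₀) α
      ≡⟨ cong₂ (λ p q → chiβ (p ∷ q ∷ column N₀) α) top second ⟩
    chiβ ((a₁ + (a₂ + u)) ∷ a₁ ∷ column N₀) α
      ≡⟨ chiβ-removeFirstTwoParts a₂ u d N μ μ⁺ N<u u<a₂ (<-≤-trans (n<1+n N) (m≤n+m (suc N) x)) d≤N₀ u≢d
                                  total residual ⟩
    + 2 ℤ.* sgn N₀
      ≡⟨ cong (λ n → + 2 ℤ.* sgn n) n≡ ⟨
    + 2 ℤ.* sgn n ∎)
  where
  open ≡-Reasoning
  open ℕSolver
  d  = x + suc N
  a₁ = a₂ + d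
  α  = a₁ ∷ a₂ ∷ μ
  u  = sum μ ∸ x
  m  = sum (a₁ ∷ a₂ ∷ μ) ∸ a₁
  n  = a₁ ∸ x ∸ 1
  N₀ = a₂ + N
  x<a₂ : x < a₂
  x<a₂ = ≤-<-trans (≤-trans (m≤m+n x (suc N)) d≤Σ) Σ<a₂
  Σ≡ : sum μ ≡ u + x
  Σ≡ = sym (m∸n+n≡m (≤-trans (m≤m+n x (suc N)) d≤Σ))
  m≡ : m ≡ a₂ + sum μ
  m≡ = m+n∸m≡n a₁ (a₂ + sum μ)
  x+1≤m : x + 1 ≤ m
  x+1≤m = ≤-trans (≤-reflexive (+-comm x 1)) (≤-trans x<a₂ (≤-trans (m≤m+n a₂ (sum μ)) (≤-reflexive (sym m≡))))
  n≡ : n ≡ N₀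
  n≡ = trans (cong (λ z → z ∸ x ∸ 1) (solve 3 (λ a x n → a :+ (x :+ (con 1 :+ n)) := x :+ (con 1 :+ (a :+ n)))
                                              refl a₂ x N))
             (cong (_∸ 1) (m+n∸m≡n x (suc N₀)))
  hook-total : (x + 1 ∸ 1) + n + 1 ≡ a₁
  hook-total rewrite m+n∸n≡m x 1 | n≡ =
    solve 3 (λ x a n → x :+ (a :+ n) :+ con 1 := a :+ (x :+ (con 1 :+ n))) refl x a₂ N
  top : m + suc N₀ ≡ a₁ + (a₂ + u)
  top = trans (cong (_+ suc N₀) (trans m≡ (cong (_+_ a₂) Σ≡)))
              (solve 4 (λ a u x n → a :+ (u :+ x) :+ (con 1 :+ (a :+ n)) := a :+ (x :+ (con 1 :+ n)) :+ (a :+ u))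
                       refl a₂ u x N)
  total : d + u ≡ suc N + sum μ
  total = trans (solve 3 (λ x n u → x :+ (con 1 :+ n) :+ u := con 1 :+ n :+ (u :+ x)) refl x N u)
                (cong (_+_ (suc N)) (sym Σ≡))
  second : x + 1 + N₀ ≡ a₁
  second = solve 3 (λ x a n → x :+ con 1 :+ (a :+ n) := a :+ (x :+ (con 1 :+ n))) refl x a₂ N
  N<u : N < u
  N<u = ≤-trans (≤-reflexive (sym (m+n∸m≡n x (suc N)))) (∸-monoˡ-≤ x d≤Σ)
  u<a₂ : u < a₂
  u<a₂ = ≤-<-trans (m∸n≤m (sum μ) x) Σ<a₂
  d≤N₀ : d ≤ N₀
  d≤N₀ = ≤-trans (≤-reflexive (+-suc x N)) (+-monoˡ-≤ N x<a₂)

-- Locating the segment (α_{k−1}, …, α_h)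

SignShape-unstep : ∀ {a γ} → SignShape (a ∷ γ) → a > sum γ → SignShape γ
SignShape-unstep (step _ shape) _ = shape
SignShape-unstep (base sb-11) (s≤s ())
SignShape-unstep (base sb-3211) (s≤s (s≤s (s≤s ())))
SignShape-unstep (base sb-5321) (s≤s (s≤s (s≤s (s≤s (s≤s ())))))
SignShape-unstep (base (sb-aa1 a _)) a>Σ = ⊥-elim (<⇒≱ a>Σ (≤∸1+suc a 0))
SignShape-unstep (base (sb-aa21 a _)) a>Σ = ⊥-elim (<⇒≱ a>Σ (≤∸1+suc a 2))
SignShape-unstep (base (sb-aa31 a _)) a>Σ = ⊥-elim (<⇒≱ a>Σ (≤∸1+suc a 3))

gap≤sum-tail : ∀ a₁ a₂ rest → IsPartition (a₁ ∷ a₂ ∷ rest) → SignShape (a₂ ∷ rest) →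
  ¬ Sign (a₁ ∷ a₂ ∷ rest) → a₁ ∸ a₂ ≤ sum rest
gap≤sum-tail a₁ a₂ rest α⁺ shape α∉Sign =
  ≤-trans (∸-monoˡ-≤ a₂ (≮⇒≥ (λ a₁>Σ → α∉Sign (α⁺ , step a₁>Σ shape)))) (≤-reflexive (m+n∸m≡n a₂ (sum rest)))

index≥4 : ∀ a₁ a₂ rest k → sum (drop (k ∸ 1) (a₁ ∷ a₂ ∷ rest)) < sum rest → ∃[ j ] k ≡ 4 + j
index≥4 a₁ a₂ rest 0 short = ⊥-elim (<⇒≱ short (sum-drop-≤ 2 (a₁ ∷ a₂ ∷ rest)))
index≥4 a₁ a₂ rest 1 short = ⊥-elim (<⇒≱ short (sum-drop-≤ 2 (a₁ ∷ a₂ ∷ rest)))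
index≥4 a₁ a₂ rest 2 short = ⊥-elim (<⇒≱ short (sum-drop-≤ 1 (a₂ ∷ rest)))
index≥4 a₁ a₂ rest 3 short = ⊥-elim (<-irrefl refl short)
index≥4 a₁ a₂ rest (suc (suc (suc (suc j)))) _ = j , refl

drop-view : ∀ j (L : List ℕ) → j < length L →
  ∃[ e ] ∃[ ρ ] (drop j L ≡ e ∷ ρ × drop (suc j) L ≡ ρ × part L (suc j) ≡ e)
drop-view zero    (e ∷ ρ) _       = e , ρ , refl , refl , refl
drop-view (suc j) (_ ∷ L) (s≤s j<) = drop-view j L j<

theorem4 : (a₁ a₂ : ℕ) (rest : List ℕ) (k : ℕ) →
  let α = a₁ ∷ a₂ ∷ rest
      h = length α
      tail = λ (i : ℕ) → sum (drop (i ∸ 1) α)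
      x = tail k
      seg = drop (k ∸ 2) α
      s = sum seg
  in IsPartition α →
     1 ≤ k → k ≤ h + 1 → tail k < a₁ ∸ a₂ →
     (∀ j → 1 ≤ j → j < k → ¬ (tail j < a₁ ∸ a₂)) →
     ¬ Sign α → Sign (a₂ ∷ rest) → a₁ > a₂ → a₂ > sum rest →
     k ≤ h →
     ¬ ((a₁ ∸ a₂) ∈ α) →
     part α (k ∸ 1) ≤ x →
     ¬ ((seg ≡ 3 ∷ 2 ∷ 1 ∷ 1 ∷ [] × a₁ ≡ a₂ + s)
       ⊎ (seg ≡ 5 ∷ 3 ∷ 2 ∷ 1 ∷ [] × a₁ ≡ a₂ + s)
       ⊎ (∃[ a ] (2 ≤ a × seg ≡ a ∷ (a ∸ 1) ∷ 1 ∷ [] × a₁ ≡ (a₂ + s) ∸ 1))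
       ⊎ (∃[ a ] (4 ≤ a × seg ≡ a ∷ (a ∸ 1) ∷ 2 ∷ 1 ∷ [] × a₁ ≡ (a₂ + s) ∸ 3))
       ⊎ (∃[ a ] (5 ≤ a × seg ≡ a ∷ (a ∸ 1) ∷ 3 ∷ 1 ∷ [] × a₁ ≡ (a₂ + s) ∸ 4))) →
     let β = (sum α ∸ a₁) ∷ (x + 1) ∷ replicate (a₁ ∸ x ∸ 1) 1
     in IsPartition β × hook β 2 1 ≡ a₁ × χ β α ≡ (+ 2) ℤ.* sgn (a₁ ∸ x ∸ 1)
theorem4 a₁ a₂ rest k α⁺@(_ , _ ∷ _ ∷ rest⁺) _ _ x<d minimal α∉Sign (_ , shape) a₂<a₁ Σ<a₂ k≤h d∉α
         e≤x not-exceptional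
  with index≥4 a₁ a₂ rest k (<-≤-trans x<d (gap≤sum-tail a₁ a₂ rest α⁺ shape α∉Sign))
... | j , refl with drop-view j rest (<⇒≤ (≤-pred (≤-pred k≤h)))
... | e , ρ , seg≡ , rest≡ , part≡ =
  subst₂ (λ a y → HookShapeFacts a a₂ rest y) a₁≡ (cong sum (sym rest≡))
         (hookShapeFacts a₂ rest x N rest⁺ d≤Σ Σ<a₂ residual)
  where
  d = a₁ ∸ a₂
  x = sum ρ
  N = d ∸ x ∸ 1
  d≡ : d ≡ x + suc N
  d≡ = ∸-split (subst (_< d) (cong sum rest≡) x<d)
  a₁≡ : a₂ + (x + suc N) ≡ a₁
  a₁≡ = trans (cong (_+_ a₂) (sym d≡)) (m+[n∸m]≡n (<⇒≤ a₂<a₁))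
  d≤Σ : x + suc N ≤ sum rest
  d≤Σ = subst (_≤ sum rest) d≡ (gap≤sum-tail a₁ a₂ rest α⁺ shape α∉Sign)
  d≤x+e : d ≤ x + e
  d≤x+e = subst (d ≤_) (trans (cong sum seg≡) (+-comm e x)) (≮⇒≥ (minimal (3 + j) (s≤s z≤n) (n<1+n _)))
  N<e : N < e
  N<e = +-cancelˡ-≤ x (suc N) e (subst (_≤ x + e) d≡ d≤x+e)
  d∉ : x + suc N ∉ rest
  d∉ = d∉α ∘ there ∘ there ∘ subst (_∈ rest) (sym d≡)
  ¬exc : ¬ Exceptional (e ∷ ρ) (x + suc N)
  ¬exc = not-exceptional ∘ subst (λ seg → ExceptionalFor seg a₁ a₂) (sym seg≡)
                         ∘ subst (λ a → ExceptionalFor (e ∷ ρ) a a₂) a₁≡ ∘ ExceptionalFor-shift a₂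
  residual : ResidualValue rest x N
  residual = residualValue rest (SignShape-unstep shape Σ<a₂) rest⁺ j e ρ seg≡
                           (subst₂ _≤_ part≡ (cong sum rest≡) e≤x) N N<e d∉ ¬exc
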